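{- There is an absolute constant $c>0$ such that the following holds. For any $\varepsilon>0$ there is a $\delta=\delta(\varepsilon)\ge c\varepsilon$ (i.e. $\delta=\Omega(\varepsilon)$) such that for every triangle-free $n$-vertex graph $G$, if $\mathrm{im}(G)<(1-\varepsilon)\frac{n}{2}$, then $\log\mathrm{mis}(G)<\left(\frac{1}{2}-\delta\right)n$.
   Context: $\mathrm{mis}(G)$ denotes the number of maximal independent sets of $G$, and $\log=\log_2$. An induced matching of $G$ is an induced subgraph of $G$ that is a matching; $\mathrm{im}(G)$ is the number of edges in a largest induced matching of $G$.
   Formalization: The parameter ε ranges over the positive rationals, and the constants c and δ are also taken to be rational. -}

module Defs where

open import Data.Bool using (Bool; true; false; not; _∧_; _∨_; if_then_else_)
open import Data.Nat using (ℕ; zero; suc; _^_; _⊔_) renaming (_<_ to _<ℕ_)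
open import Data.Nat.DivMod using (_/_)
open import Data.Fin using (Fin)
open import Data.Vec using (Vec; []; _∷_; lookup)
open import Data.List using (List; []; _∷_; _++_; map; allFin; foldr)
open import Data.Bool.ListAction using (all; any)
open import Data.Integer using (+_)
open import Data.Rational using (ℚ; ↥_; ↧ₙ_)
open import Data.Product using (Σ; _×_)
open import Data.Empty using (⊥)
open import Relation.Binary.PropositionalEquality using (_≡_)

record Graph (n : ℕ) : Set where
  field
    adj   : Fin n → Fin n → Bool
    sym   : ∀ u v → adj u v ≡ adj v u
    irref : ∀ u → adj u u ≡ false
open Graph public

TriangleFree : ∀ {n} → Graph n → Set
TriangleFree G = ∀ u v w → adj G u v ≡ true → adj G v w ≡ true → adj G u w ≡ true → ⊥

VSet : ℕ → Set
VSet n = Vec Bool n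

allSubsets : (n : ℕ) → List (VSet n)
allSubsets zero = [] ∷ []
allSubsets (suc n) = map (true ∷_) (allSubsets n) ++ map (false ∷_) (allSubsets n)

countB : ∀ {A : Set} → (A → Bool) → List A → ℕ
countB p [] = 0
countB p (x ∷ xs) = if p x then suc (countB p xs) else countB p xs

module _ {n : ℕ} (G : Graph n) where
  V : List (Fin n)
  V = allFin n

  isIndependent : VSet n → Bool
  isIndependent S = all (λ u → all (λ v → not (lookup S u ∧ lookup S v ∧ adj G u v)) V) V

  isMaximalIndependent : VSet n → Bool
  isMaximalIndependent S =
    isIndependent S ∧ all (λ v → lookup S v ∨ any (λ u → lookup S u ∧ adj G u v) V) V

  mis : ℕ
  mis = countB isMaximalIndependent (allSubsets n)

  isInducedMatching : VSet n → Bool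
  isInducedMatching U =
    all (λ u → not (lookup U u) ∨ (countB (λ v → lookup U v ∧ adj G u v) V Data.Nat.≡ᵇ 1)) V

  size : VSet n → ℕ
  size U = countB (λ u → lookup U u) V / 2

  im : ℕ
  im = foldr (λ U acc → (if isInducedMatching U then size U else 0) ⊔ acc) 0 (allSubsets n)

-- Log2Lt m r  means  log₂ m < r  (for m ≥ 1): with r = p/q in lowest terms,
-- this is q·log₂ m < p, i.e. p ≥ 0 and m^q < 2^p.
Log2Lt : ℕ → ℚ → Set
Log2Lt m r = Σ ℕ (λ p → (↥ r ≡ + p) × (m ^ (↧ₙ r) <ℕ 2 ^ p))

module Submission where

-- For a vertex set W of a triangle-free graph G let mis(W) and im(W) be the number
-- of maximal independent sets and the induced matching number of G[W].  The core
-- is the inequality (mis-bound)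
--     mis(W) · 5^|W| · 49^im(W)  ≤  7^|W| · 50^im(W),
-- proved by induction on |W|, branching on a vertex v of minimum degree in G[W]:
-- an isolated v lies in every maximal independent set; if deg v ≥ 3 then
-- mis(W) ≤ mis(W − v) + mis(W ∖ N[v]); if v is pendant with neighbour u, every
-- maximal independent set contains exactly one of u, v, and the edge uv extends
-- every induced matching of W ∖ N[u]; if all degrees are 2 we branch along a path
-- v₀ u x, which has no chord v₀x because G is triangle-free.
-- Writing n = 2·im + d, the inequality yields mis¹⁰⁰ · 2^d ≤ 2^(50n), and
-- im < (1 − ε)n/2 means d > εn, so log₂ mis < (1/2 − ε/100)·n (log-mis-bound).

open import Defs hiding (sym)

module LogMisBound where

  open import Data.Bool using (Bool; true; false; not; _∧_; _∨_; if_then_else_; T)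
  open import Data.Bool.Properties using (T-≡; not-¬; ¬-not; not-injective; ∧-zeroʳ; ∧-identityʳ; ∨-zeroʳ; ∧-conicalˡ; ∧-conicalʳ; ∨-conicalˡ; ∨-conicalʳ) renaming (_≟_ to _≟ᵇ_)
  open import Data.Bool.ListAction using (all; any)
  open import Data.Nat using (ℕ; zero; suc; pred; _+_; _*_; _^_; _∸_; _⊔_; _≤_; _<_; z≤n; s≤s; _≡ᵇ_; _≤ᵇ_; _≟_; _≤?_; _<?_; NonZero; >-nonZero)
  open import Data.Nat.DivMod using (_/_; m/n≡1+[m∸n]/n)
  open import Data.Nat.Properties
  open import Data.Nat.Tactic.RingSolver using (solve-∀)
  open import Algebra.Properties.CommutativeSemigroup +-commutativeSemigroup using () renaming (interchange to +-interchange)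
  open import Data.Fin using (Fin; zero; suc)
  open import Data.Fin.Properties using (all?; any?) renaming (_≟_ to _≟ᶠ_; suc-injective to sucᶠ-injective)
  open import Data.Vec using ([]; _∷_; lookup; replicate; _[_]≔_)
  open import Data.Vec.Properties using (lookup∘update; lookup∘update′; lookup-replicate)
  open import Data.List using (List; []; _∷_; _++_; map; foldr; tabulate; allFin)
  open import Data.List.Membership.Propositional using (_∈_)
  open import Data.List.Membership.Propositional.Properties using (∈-map⁺; ∈-++⁺ˡ; ∈-++⁺ʳ)
  open import Data.List.Relation.Unary.Any using (here; there)
  open import Data.Product using (_×_; _,_; ∃; proj₁; proj₂)
  open import Data.Empty using (⊥; ⊥-elim)
  open import Relation.Nullary using (Dec; yes; no; ¬_; does; contradiction)
  open import Relation.Nullary.Decidable using (_×-dec_; _→-dec_; map′; dec-true; dec-false)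
  open import Relation.Binary.PropositionalEquality
  open import Function using (_∘_; id)
  open import Function.Bundles using (Equivalence)
  open Equivalence using (to; from)

  𝟙 : Bool → ℕ
  𝟙 true = 1
  𝟙 false = 0

  𝟙-mono : ∀ {a b} → (a ≡ true → b ≡ true) → 𝟙 a ≤ 𝟙 b
  𝟙-mono {false} a⇒b = z≤n
  𝟙-mono {true} a⇒b rewrite a⇒b refl = ≤-refl

  ∧-intro : ∀ {a b} → a ≡ true → b ≡ true → a ∧ b ≡ true
  ∧-intro refl refl = refl

  from-does : ∀ {A : Set} (d : Dec A) → does d ≡ true → A
  from-does (yes a) _ = a
  from-does (no _) ()

  does-unique : ∀ {A : Set} (b : Bool) (d : Dec A) → (b ≡ true → A) → (A → b ≡ true) → b ≡ does d
  does-unique true d sound _ = sym (dec-true d (sound refl))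
  does-unique false d _ complete = sym (dec-false d (λ a → contradiction (complete a) λ ()))

  VPred : ℕ → Set
  VPred n = Fin n → Bool

  infixl 7 _∩_ _∖_
  _∩_ _∖_ : ∀ {n} → VPred n → VPred n → VPred n
  (W ∩ N) x = W x ∧ N x
  (W ∖ N) x = W x ∧ not (N x)

  ∖-intro : ∀ {n} (W N : VPred n) x → W x ≡ true → N x ≡ false → (W ∖ N) x ≡ true
  ∖-intro W N x Wx Nx rewrite Wx | Nx = refl
  ∖-⊆ : ∀ {n} (W N : VPred n) x → (W ∖ N) x ≡ true → W x ≡ true
  ∖-⊆ W N x = ∧-conicalˡ (W x) _
  ∖-∉ : ∀ {n} (W N : VPred n) x → (W ∖ N) x ≡ true → N x ≡ false
  ∖-∉ W N x h = not-injective (∧-conicalʳ (W x) _ h)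

  -- Boolean equality of vertices, reflecting ≡; (_== u) is the singleton {u}.
  _==_ : ∀ {n} → Fin n → Fin n → Bool
  x == y = does (x ≟ᶠ y)
  ==-refl : ∀ {n} (x : Fin n) → (x == x) ≡ true
  ==-refl x with x ≟ᶠ x
  ... | yes _ = refl
  ... | no x≢x = contradiction refl x≢x
  ==-true : ∀ {n} {x y : Fin n} → x ≡ y → (x == y) ≡ true
  ==-true {x = x} refl = ==-refl x
  ==-false : ∀ {n} {x y : Fin n} → x ≢ y → (x == y) ≡ false
  ==-false {x = x} {y} x≢y with x ≟ᶠ y
  ... | yes x≡y = contradiction x≡y x≢y
  ... | no _ = refl

  count : ∀ {n} → VPred n → ℕ
  count {zero} f = 0
  count {suc n} f = 𝟙 (f zero) + count (f ∘ suc)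

  count-cong : ∀ {n} (f g : VPred n) → (∀ x → f x ≡ g x) → count f ≡ count g
  count-cong {zero} f g f≗g = refl
  count-cong {suc n} f g f≗g = cong₂ _+_ (cong 𝟙 (f≗g zero)) (count-cong (f ∘ suc) (g ∘ suc) (f≗g ∘ suc))

  count-none : ∀ {n} (f : VPred n) → (∀ x → f x ≡ false) → count f ≡ 0
  count-none {zero} f f≡∅ = refl
  count-none {suc n} f f≡∅ rewrite f≡∅ zero = count-none (f ∘ suc) (f≡∅ ∘ suc)

  count-≥1 : ∀ {n} (f : VPred n) x → f x ≡ true → 1 ≤ count f
  count-≥1 f zero fx rewrite fx = s≤s z≤n
  count-≥1 f (suc x) fx = ≤-trans (count-≥1 (f ∘ suc) x fx) (m≤n+m _ (𝟙 (f zero)))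
  count-witness : ∀ {n} (f : VPred n) → 1 ≤ count f → ∃ λ x → f x ≡ true
  count-witness {suc n} f pos with f zero in f0
  ... | true = zero , f0
  ... | false with count-witness (f ∘ suc) pos
  ... | x , fx = suc x , fx

  count-insert : ∀ {n} (f g : VPred n) (v : Fin n) → f v ≡ false → g v ≡ true →
    (∀ x → x ≢ v → f x ≡ g x) → count g ≡ suc (count f)
  count-insert f g zero fv gv same rewrite fv | gv =
    cong suc (sym (count-cong (f ∘ suc) (g ∘ suc) (λ x → same (suc x) λ ())))
  count-insert f g (suc v) fv gv same rewrite same zero (λ ()) =
    trans (cong (𝟙 (g zero) +_) (count-insert (f ∘ suc) (g ∘ suc) v fv gv (λ x x≢v → same (suc x) (x≢v ∘ sucᶠ-injective))))
          (+-suc (𝟙 (g zero)) _)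

  count-singleton : ∀ {n} (u : Fin n) → count (_== u) ≡ 1
  count-singleton {n} u = trans (count-insert {n} (λ _ → false) (_== u) u refl (==-refl u) (λ x x≢u → sym (==-false x≢u)))
                            (cong suc (count-none {n} (λ _ → false) (λ _ → refl)))

  count-remove : ∀ {n} (f : VPred n) (v : Fin n) → f v ≡ true → count f ≡ suc (count (f ∖ (_== v)))
  count-remove f v fv = count-insert (f ∖ (_== v)) f v removed fv kept
    where
    removed : (f ∖ (_== v)) v ≡ false
    removed rewrite ==-refl v = ∧-zeroʳ (f v)
    kept : ∀ x → x ≢ v → (f ∖ (_== v)) x ≡ f x
    kept x x≢v rewrite ==-false x≢v = ∧-identityʳ (f x)

  count-unique : ∀ {n} (f : VPred n) {u x} → count f ≡ 1 → f u ≡ true → f x ≡ true → x ≡ u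
  count-unique f {u} {x} one fu fx with x ≟ᶠ u
  ... | yes x≡u = x≡u
  ... | no x≢u = contradiction (≤-trans (count-≥1 (f ∖ (_== u)) x fx′) (≤-reflexive rest≡0)) λ ()
    where
    rest≡0 : count (f ∖ (_== u)) ≡ 0
    rest≡0 = suc-injective (trans (sym (count-remove f u fu)) one)
    fx′ : (f ∖ (_== u)) x ≡ true
    fx′ rewrite ==-false x≢u | fx = refl

  count-split : ∀ {n} (f g : VPred n) → count f ≡ count (f ∩ g) + count (f ∖ g)
  count-split {zero} f g = refl
  count-split {suc n} f g =
    trans (cong₂ _+_ (𝟙-split (f zero) (g zero)) (count-split (f ∘ suc) (g ∘ suc)))
          (+-interchange (𝟙 ((f ∩ g) zero)) _ _ _)
    where
    𝟙-split : ∀ a b → 𝟙 a ≡ 𝟙 (a ∧ b) + 𝟙 (a ∧ not b)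
    𝟙-split true true = refl
    𝟙-split true false = refl
    𝟙-split false b = refl

  -- The list functions countB, all and any of Defs, read on tabulated lists
  -- (the vertex list V = allFin n is tabulate id).
  countB-tabulate : ∀ {A : Set} {n} (p : A → Bool) (g : Fin n → A) → countB p (tabulate g) ≡ count (p ∘ g)
  countB-tabulate {n = zero} p g = refl
  countB-tabulate {n = suc n} p g with p (g zero)
  ... | true = cong suc (countB-tabulate p (g ∘ suc))
  ... | false = countB-tabulate p (g ∘ suc)
  all-tabulate⁻ : ∀ {A : Set} {n} (p : A → Bool) (g : Fin n → A) → all p (tabulate g) ≡ true → ∀ i → p (g i) ≡ true
  all-tabulate⁻ {n = suc n} p g all-p i with p (g zero) in pg0
  all-tabulate⁻ {n = suc n} p g all-p zero | true = pg0
  all-tabulate⁻ {n = suc n} p g all-p (suc i) | true = all-tabulate⁻ p (g ∘ suc) all-p i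
  all-tabulate⁺ : ∀ {A : Set} {n} (p : A → Bool) (g : Fin n → A) → (∀ i → p (g i) ≡ true) → all p (tabulate g) ≡ true
  all-tabulate⁺ {n = zero} p g every = refl
  all-tabulate⁺ {n = suc n} p g every rewrite every zero = all-tabulate⁺ p (g ∘ suc) (every ∘ suc)
  any-tabulate⁻ : ∀ {A : Set} {n} (p : A → Bool) (g : Fin n → A) → any p (tabulate g) ≡ true → ∃ λ i → p (g i) ≡ true
  any-tabulate⁻ {n = suc n} p g any-p with p (g zero) in pg0
  ... | true = zero , pg0
  ... | false with any-tabulate⁻ p (g ∘ suc) any-p
  ... | i , pgi = suc i , pgi
  any-tabulate⁺ : ∀ {A : Set} {n} (p : A → Bool) (g : Fin n → A) → ∃ (λ i → p (g i) ≡ true) → any p (tabulate g) ≡ true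
  any-tabulate⁺ {n = suc n} p g (zero , pg0) rewrite pg0 = refl
  any-tabulate⁺ {n = suc n} p g (suc i , pgi) with p (g zero)
  ... | true = refl
  ... | false = any-tabulate⁺ p (g ∘ suc) (i , pgi)

  countB-++ : ∀ {A : Set} (p : A → Bool) xs ys → countB p (xs ++ ys) ≡ countB p xs + countB p ys
  countB-++ p [] ys = refl
  countB-++ p (x ∷ xs) ys with p x
  ... | true = cong suc (countB-++ p xs ys)
  ... | false = countB-++ p xs ys
  countB-map : ∀ {A B : Set} (p : B → Bool) (g : A → B) xs → countB p (map g xs) ≡ countB (p ∘ g) xs
  countB-map p g [] = refl
  countB-map p g (x ∷ xs) with p (g x)
  ... | true = cong suc (countB-map p g xs)
  ... | false = countB-map p g xs

  -- The sum of f over all 2ⁿ vertex subsets, split on the first vertex.  mis(G[W]) is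
  -- such a sum of indicators; its branching rules come from pairing S ∌ v with S ∪ {v}.
  sumAll : ∀ {n} → (VSet n → ℕ) → ℕ
  sumAll {zero} f = f []
  sumAll {suc n} f = sumAll (f ∘ (true ∷_)) + sumAll (f ∘ (false ∷_))

  countB-allSubsets : ∀ {n} (p : VSet n → Bool) → countB p (allSubsets n) ≡ sumAll (𝟙 ∘ p)
  countB-allSubsets {zero} p with p []
  ... | true = refl
  ... | false = refl
  countB-allSubsets {suc n} p = begin
      countB p (map (true ∷_) subsets ++ map (false ∷_) subsets)
    ≡⟨ countB-++ p (map (true ∷_) subsets) (map (false ∷_) subsets) ⟩
      countB p (map (true ∷_) subsets) + countB p (map (false ∷_) subsets)
    ≡⟨ cong₂ _+_ (countB-map p (true ∷_) subsets) (countB-map p (false ∷_) subsets) ⟩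
      countB (p ∘ (true ∷_)) subsets + countB (p ∘ (false ∷_)) subsets
    ≡⟨ cong₂ _+_ (countB-allSubsets (p ∘ (true ∷_))) (countB-allSubsets (p ∘ (false ∷_))) ⟩
      sumAll (𝟙 ∘ p) ∎
    where
    open ≡-Reasoning
    subsets = allSubsets n

  sumAll-cong : ∀ {n} (f g : VSet n → ℕ) → (∀ S → f S ≡ g S) → sumAll f ≡ sumAll g
  sumAll-cong {zero} f g f≗g = f≗g []
  sumAll-cong {suc n} f g f≗g =
    cong₂ _+_ (sumAll-cong (f ∘ (true ∷_)) (g ∘ (true ∷_)) (f≗g ∘ (true ∷_)))
              (sumAll-cong (f ∘ (false ∷_)) (g ∘ (false ∷_)) (f≗g ∘ (false ∷_)))
  sumAll-mono : ∀ {n} (f g : VSet n → ℕ) → (∀ S → f S ≤ g S) → sumAll f ≤ sumAll g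
  sumAll-mono {zero} f g f≤g = f≤g []
  sumAll-mono {suc n} f g f≤g =
    +-mono-≤ (sumAll-mono (f ∘ (true ∷_)) (g ∘ (true ∷_)) (f≤g ∘ (true ∷_)))
             (sumAll-mono (f ∘ (false ∷_)) (g ∘ (false ∷_)) (f≤g ∘ (false ∷_)))
  sumAll-+ : ∀ {n} (f g : VSet n → ℕ) → sumAll (λ S → f S + g S) ≡ sumAll f + sumAll g
  sumAll-+ {zero} f g = refl
  sumAll-+ {suc n} f g =
    trans (cong₂ _+_ (sumAll-+ (f ∘ (true ∷_)) (g ∘ (true ∷_))) (sumAll-+ (f ∘ (false ∷_)) (g ∘ (false ∷_))))
          (+-interchange (sumAll (f ∘ (true ∷_))) _ _ _)
  sumAll-zero : ∀ {n} → sumAll {n} (λ _ → 0) ≡ 0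
  sumAll-zero {zero} = refl
  sumAll-zero {suc n} rewrite sumAll-zero {n} = refl

  isEmpty : ∀ {n} → VSet n → Bool
  isEmpty [] = true
  isEmpty (b ∷ S) = not b ∧ isEmpty S
  isEmpty-intro : ∀ {n} (S : VSet n) → (∀ x → lookup S x ≡ false) → isEmpty S ≡ true
  isEmpty-intro [] none = refl
  isEmpty-intro (b ∷ S) none rewrite none zero = isEmpty-intro S (none ∘ suc)
  sumAll-isEmpty : ∀ {n} → sumAll {n} (𝟙 ∘ isEmpty) ≡ 1
  sumAll-isEmpty {zero} = refl
  sumAll-isEmpty {suc n} = cong₂ _+_ (sumAll-zero {n}) (sumAll-isEmpty {n})

  insert : ∀ {n} → Fin n → VSet n → VSet n
  insert v S = S [ v ]≔ true

  insert-∈ : ∀ {n} (v : Fin n) S → lookup (insert v S) v ≡ true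
  insert-∈ v S = lookup∘update v S true
  insert-keeps : ∀ {n} (v x : Fin n) S → x ≢ v → lookup (insert v S) x ≡ lookup S x
  insert-keeps v x S x≢v = lookup∘update′ x≢v S true
  lookup-insert : ∀ {n} (v x : Fin n) S → lookup (insert v S) x ≡ (x == v) ∨ lookup S x
  lookup-insert v x S with x ≟ᶠ v
  ... | yes refl = insert-∈ v S
  ... | no x≢v = insert-keeps v x S x≢v

  count-insert-∉ : ∀ {n} (v : Fin n) S → lookup S v ≡ false → count (lookup (insert v S)) ≡ suc (count (lookup S))
  count-insert-∉ v S Sv = count-insert (lookup S) (lookup (insert v S)) v Sv (insert-∈ v S) (λ x x≢v → sym (insert-keeps v x S x≢v))

  ∉-≢ : ∀ {n} (S : VSet n) v x → lookup S v ≡ false → lookup S x ≡ true → x ≢ v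
  ∉-≢ S v x Sv Sx refl = contradiction (trans (sym Sx) Sv) λ ()

  sumAll-pairs : ∀ {n} (v : Fin n) (f : VSet n → ℕ) →
    sumAll f ≡ sumAll (λ S → if lookup S v then 0 else f S + f (insert v S))
  sumAll-pairs {suc n} zero f = begin
      sumAll (f ∘ (true ∷_)) + sumAll (f ∘ (false ∷_))
    ≡⟨ +-comm (sumAll (f ∘ (true ∷_))) _ ⟩
      sumAll (f ∘ (false ∷_)) + sumAll (f ∘ (true ∷_))
    ≡⟨ sym (sumAll-+ (f ∘ (false ∷_)) (f ∘ (true ∷_))) ⟩
      sumAll (λ S → f (false ∷ S) + f (true ∷ S))
    ≡⟨ cong (_+ sumAll (λ S → f (false ∷ S) + f (true ∷ S))) (sym (sumAll-zero {n})) ⟩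
      sumAll {n} (λ _ → 0) + sumAll (λ S → f (false ∷ S) + f (true ∷ S)) ∎
    where open ≡-Reasoning
  sumAll-pairs {suc n} (suc v) f = cong₂ _+_ (sumAll-pairs v (f ∘ (true ∷_))) (sumAll-pairs v (f ∘ (false ∷_)))

  sumAll-branch : ∀ {n} (v : Fin n) (f g h : VSet n → ℕ) →
    (∀ S → lookup S v ≡ false → f S + f (insert v S) ≤ g S + h S) → sumAll f ≤ sumAll g + sumAll h
  sumAll-branch v f g h pair≤ = begin
      sumAll f
    ≡⟨ sumAll-pairs v f ⟩
      sumAll (λ S → if lookup S v then 0 else f S + f (insert v S))
    ≤⟨ sumAll-mono _ _ pointwise ⟩
      sumAll (λ S → g S + h S)
    ≡⟨ sumAll-+ g h ⟩
      sumAll g + sumAll h ∎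
    where
    open ≤-Reasoning
    pointwise : ∀ S → (if lookup S v then 0 else f S + f (insert v S)) ≤ g S + h S
    pointwise S with lookup S v in Sv
    ... | true = z≤n
    ... | false = pair≤ S Sv

  sumAll-branch₂ : ∀ {n} (u v : Fin n) → u ≢ v → (f g h : VSet n → ℕ) →
    (∀ S → lookup S u ≡ false → lookup S v ≡ false →
       (f S + f (insert v S)) + (f (insert u S) + f (insert v (insert u S))) ≤ g S + h S) →
    sumAll f ≤ sumAll g + sumAll h
  sumAll-branch₂ u v u≢v f g h quad≤ = begin
      sumAll f
    ≡⟨ sumAll-pairs v f ⟩
      sumAll pairsOnV
    ≤⟨ sumAll-branch u pairsOnV g h pointwise ⟩
      sumAll g + sumAll h ∎
    where
    open ≤-Reasoning
    pairsOnV : VSet _ → ℕ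
    pairsOnV S = if lookup S v then 0 else f S + f (insert v S)
    pointwise : ∀ S → lookup S u ≡ false → pairsOnV S + pairsOnV (insert u S) ≤ g S + h S
    pointwise S Su rewrite insert-keeps u v S (u≢v ∘ sym) with lookup S v in Sv
    ... | true = z≤n
    ... | false = quad≤ S Su Sv

  allSubsets-complete : ∀ {n} (S : VSet n) → S ∈ allSubsets n
  allSubsets-complete [] = here refl
  allSubsets-complete {suc n} (true ∷ S) = ∈-++⁺ˡ (∈-map⁺ (true ∷_) (allSubsets-complete S))
  allSubsets-complete {suc n} (false ∷ S) = ∈-++⁺ʳ (map (true ∷_) (allSubsets n)) (∈-map⁺ (false ∷_) (allSubsets-complete S))

  maxOver : ∀ {X : Set} → (X → ℕ) → List X → ℕ
  maxOver g = foldr (λ U acc → g U ⊔ acc) 0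
  maxOver-≥ : ∀ {X : Set} (g : X → ℕ) L U → U ∈ L → g U ≤ maxOver g L
  maxOver-≥ g (x ∷ L) U (here refl) = m≤m⊔n (g x) (maxOver g L)
  maxOver-≥ g (x ∷ L) U (there U∈L) = ≤-trans (maxOver-≥ g L U U∈L) (m≤n⊔m (g x) (maxOver g L))
  maxOver-≤ : ∀ {X : Set} (g : X → ℕ) L M → (∀ U → g U ≤ M) → maxOver g L ≤ M
  maxOver-≤ g [] M g≤M = z≤n
  maxOver-≤ g (x ∷ L) M g≤M = ⊔-lub (g≤M x) (maxOver-≤ g L M g≤M)
  maxOver-< : ∀ {X : Set} (g : X → ℕ) L M → 0 < M → (∀ U → g U < M) → maxOver g L < M
  maxOver-< g [] M 0<M g<M = 0<M
  maxOver-< g (x ∷ L) M 0<M g<M = ⊔-lub (g<M x) (maxOver-< g L M 0<M g<M)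
  maxOver-cong : ∀ {X : Set} (g h : X → ℕ) L → (∀ U → g U ≡ h U) → maxOver g L ≡ maxOver h L
  maxOver-cong g h [] g≗h = refl
  maxOver-cong g h (x ∷ L) g≗h = cong₂ _⊔_ (g≗h x) (maxOver-cong g h L g≗h)

  by-computation : ∀ m n → {T (m ≤ᵇ n)} → m ≤ n
  by-computation m n {m≤n} = ≤ᵇ⇒≤ m n m≤n

  -- Bound s m x:  x ≤ (7/5)^s · (50/49)^m, the bound proved for mis(G[W]) with
  -- s = |W| and m = im(G[W]).  Its recurrences below match the branching rules.
  Bound : ℕ → ℕ → ℕ → Set
  Bound s m x = x * (5 ^ s * 49 ^ m) ≤ 7 ^ s * 50 ^ m

  Bound-raise₁ : ∀ s m x → Bound s m x → Bound s (suc m) x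
  Bound-raise₁ s m x h = begin
      x * (5 ^ s * (49 * 49 ^ m))   ≡⟨ shuffle x (5 ^ s) (49 ^ m) ⟩
      49 * (x * (5 ^ s * 49 ^ m))   ≤⟨ *-monoʳ-≤ 49 h ⟩
      49 * (7 ^ s * 50 ^ m)         ≤⟨ *-monoˡ-≤ (7 ^ s * 50 ^ m) (m≤n+m 49 1) ⟩
      50 * (7 ^ s * 50 ^ m)         ≡⟨ shuffle′ (7 ^ s) (50 ^ m) ⟩
      7 ^ s * (50 * 50 ^ m)         ∎
    where
    open ≤-Reasoning
    shuffle : ∀ x a b → x * (a * (49 * b)) ≡ 49 * (x * (a * b))
    shuffle = solve-∀
    shuffle′ : ∀ a b → 50 * (a * b) ≡ a * (50 * b)
    shuffle′ = solve-∀
  Bound-raise : ∀ s m m′ x → m ≤ m′ → Bound s m x → Bound s m′ x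
  Bound-raise s m m′ x m≤m′ h = subst (λ k → Bound s k x) (m∸n+n≡m m≤m′) (raise (m′ ∸ m) h)
    where
    raise : ∀ k → Bound s m x → Bound s (k + m) x
    raise zero h = h
    raise (suc k) h = Bound-raise₁ s (k + m) x (raise k h)

  -- The empty vertex set has one maximal independent set.
  Bound-empty : ∀ m x → x ≤ 1 → Bound 0 m x
  Bound-empty m x x≤1 = begin
      x * (1 * 49 ^ m)   ≤⟨ *-monoˡ-≤ (1 * 49 ^ m) x≤1 ⟩
      1 * (1 * 49 ^ m)   ≤⟨ *-monoʳ-≤ 1 (*-monoʳ-≤ 1 (^-monoˡ-≤ m (m≤n+m 49 1))) ⟩
      1 * (1 * 50 ^ m)   ≡⟨ *-identityˡ _ ⟩
      1 * 50 ^ m         ∎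
    where open ≤-Reasoning

  -- Isolated vertex: one branch, one vertex fewer.
  Bound-isolated : ∀ s m x x₁ → x ≤ x₁ → Bound s m x₁ → Bound (suc s) m x
  Bound-isolated s m x x₁ x≤x₁ h = begin
      x * (5 * 5 ^ s * 49 ^ m)     ≤⟨ *-monoˡ-≤ (5 * 5 ^ s * 49 ^ m) x≤x₁ ⟩
      x₁ * (5 * 5 ^ s * 49 ^ m)    ≡⟨ shuffle x₁ (5 ^ s) (49 ^ m) ⟩
      5 * (x₁ * (5 ^ s * 49 ^ m))  ≤⟨ *-monoʳ-≤ 5 h ⟩
      5 * (7 ^ s * 50 ^ m)         ≤⟨ *-monoˡ-≤ (7 ^ s * 50 ^ m) (m≤n+m 5 2) ⟩
      7 * (7 ^ s * 50 ^ m)         ≡⟨ sym (*-assoc 7 (7 ^ s) (50 ^ m)) ⟩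
      7 * 7 ^ s * 50 ^ m           ∎
    where
    open ≤-Reasoning
    shuffle : ∀ x a b → x * (5 * a * b) ≡ 5 * (x * (a * b))
    shuffle = solve-∀

  -- (5/7)^j decays: the constants behind the two recurrences with a free exponent.
  5^3+j≤2·7^3+j : ∀ j → 5 * 5 ^ (3 + j) ≤ 2 * 7 ^ (3 + j)
  5^3+j≤2·7^3+j zero = by-computation 625 686
  5^3+j≤2·7^3+j (suc j) = begin
      5 * (5 * 5 ^ (3 + j))   ≤⟨ *-monoʳ-≤ 5 (5^3+j≤2·7^3+j j) ⟩
      5 * (2 * 7 ^ (3 + j))   ≤⟨ *-monoˡ-≤ (2 * 7 ^ (3 + j)) (m≤n+m 5 2) ⟩
      7 * (2 * 7 ^ (3 + j))   ≡⟨ shuffle (7 ^ (3 + j)) ⟩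
      2 * (7 * 7 ^ (3 + j))   ∎
    where
    open ≤-Reasoning
    shuffle : ∀ a → 7 * (2 * a) ≡ 2 * (7 * a)
    shuffle = solve-∀
  49·5^1+j≤48·7^1+j : ∀ j → 49 * 5 ^ (1 + j) ≤ 48 * 7 ^ (1 + j)
  49·5^1+j≤48·7^1+j zero = by-computation 245 336
  49·5^1+j≤48·7^1+j (suc j) = begin
      49 * (5 * 5 ^ (1 + j))   ≡⟨ shuffle 49 5 (5 ^ (1 + j)) ⟩
      5 * (49 * 5 ^ (1 + j))   ≤⟨ *-monoʳ-≤ 5 (49·5^1+j≤48·7^1+j j) ⟩
      5 * (48 * 7 ^ (1 + j))   ≤⟨ *-monoˡ-≤ (48 * 7 ^ (1 + j)) (m≤n+m 5 2) ⟩
      7 * (48 * 7 ^ (1 + j))   ≡⟨ shuffle 7 48 (7 ^ (1 + j)) ⟩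
      48 * (7 * 7 ^ (1 + j))   ∎
    where
    open ≤-Reasoning
    shuffle : ∀ a b c → a * (b * c) ≡ b * (a * c)
    shuffle = solve-∀

  -- A vertex of degree k ≥ 3: branches of sizes k + s and s.
  Bound-branch : ∀ k s m x x₁ x₂ → 3 ≤ k → x ≤ x₁ + x₂ → Bound (k + s) m x₁ → Bound s m x₂ → Bound (suc (k + s)) m x
  Bound-branch k s m x x₁ x₂ 3≤k x≤ h₁ h₂
    rewrite ^-distribˡ-+-* 5 k s | ^-distribˡ-+-* 7 k s = begin
      x * (5 * (a * b) * E)                        ≤⟨ *-monoˡ-≤ (5 * (a * b) * E) x≤ ⟩
      (x₁ + x₂) * (5 * (a * b) * E)                ≡⟨ expand x₁ x₂ a b E ⟩
      5 * (x₁ * (a * b * E)) + 5 * a * (x₂ * (b * E))  ≤⟨ +-mono-≤ (*-monoʳ-≤ 5 h₁) (*-mono-≤ decay h₂) ⟩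
      5 * (c * d * F) + 2 * c * (d * F)            ≡⟨ collect c d F ⟩
      7 * (c * d) * F                              ∎
    where
    open ≤-Reasoning
    a = 5 ^ k
    b = 5 ^ s
    c = 7 ^ k
    d = 7 ^ s
    E = 49 ^ m
    F = 50 ^ m
    decay : 5 * a ≤ 2 * c
    decay with m≤n⇒∃[o]m+o≡n 3≤k
    ... | j , refl = 5^3+j≤2·7^3+j j
    expand : ∀ x₁ x₂ a b E → (x₁ + x₂) * (5 * (a * b) * E) ≡ 5 * (x₁ * (a * b * E)) + 5 * a * (x₂ * (b * E))
    expand = solve-∀
    collect : ∀ c d F → 5 * (c * d * F) + 2 * c * (d * F) ≡ 7 * (c * d) * F
    collect = solve-∀

  -- A pendant vertex whose neighbour has degree k′ + 1 ≥ 2: branches of sizes k′ + s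
  -- and s, the second with a smaller induced matching number.
  Bound-pendant : ∀ k′ s m x x₁ x₂ → 1 ≤ k′ → x ≤ x₁ + x₂ → Bound (k′ + s) (suc m) x₁ → Bound s m x₂ →
    Bound (2 + (k′ + s)) (suc m) x
  Bound-pendant k′ s m x x₁ x₂ 1≤k′ x≤ h₁ h₂
    rewrite ^-distribˡ-+-* 5 k′ s | ^-distribˡ-+-* 7 k′ s = begin
      x * (5 * (5 * (a * b)) * (49 * E))                          ≤⟨ *-monoˡ-≤ (5 * (5 * (a * b)) * (49 * E)) x≤ ⟩
      (x₁ + x₂) * (5 * (5 * (a * b)) * (49 * E))                  ≡⟨ expand x₁ x₂ a b E ⟩
      25 * (x₁ * (a * b * (49 * E))) + 25 * (49 * a) * (x₂ * (b * E))  ≤⟨ +-mono-≤ (*-monoʳ-≤ 25 h₁) (*-mono-≤ (*-monoʳ-≤ 25 decay) h₂) ⟩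
      25 * (c * d * (50 * F)) + 25 * (48 * c) * (d * F)           ≡⟨ collect c d F ⟩
      7 * (7 * (c * d)) * (50 * F)                                ∎
    where
    open ≤-Reasoning
    a = 5 ^ k′
    b = 5 ^ s
    c = 7 ^ k′
    d = 7 ^ s
    E = 49 ^ m
    F = 50 ^ m
    decay : 49 * a ≤ 48 * c
    decay with m≤n⇒∃[o]m+o≡n 1≤k′
    ... | j , refl = 49·5^1+j≤48·7^1+j j
    expand : ∀ x₁ x₂ a b E → (x₁ + x₂) * (5 * (5 * (a * b)) * (49 * E)) ≡ 25 * (x₁ * (a * b * (49 * E))) + 25 * (49 * a) * (x₂ * (b * E))
    expand = solve-∀
    collect : ∀ c d F → 25 * (c * d * (50 * F)) + 25 * (48 * c) * (d * F) ≡ 7 * (7 * (c * d)) * (50 * F)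
    collect = solve-∀

  -- An isolated edge: two branches of size s, each with a smaller induced matching number.
  Bound-pendant-edge : ∀ s m x x₁ x₂ → x ≤ x₁ + x₂ → Bound s m x₁ → Bound s m x₂ → Bound (2 + s) (suc m) x
  Bound-pendant-edge s m x x₁ x₂ x≤ h₁ h₂ = begin
      x * (5 * (5 * b) * (49 * E))                      ≤⟨ *-monoˡ-≤ (5 * (5 * b) * (49 * E)) x≤ ⟩
      (x₁ + x₂) * (5 * (5 * b) * (49 * E))              ≡⟨ expand x₁ x₂ b E ⟩
      1225 * (x₁ * (b * E)) + 1225 * (x₂ * (b * E))     ≤⟨ +-mono-≤ (*-monoʳ-≤ 1225 h₁) (*-monoʳ-≤ 1225 h₂) ⟩
      1225 * (d * F) + 1225 * (d * F)                   ≡⟨ collect d F ⟩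
      7 * (7 * d) * (50 * F)                            ∎
    where
    open ≤-Reasoning
    b = 5 ^ s
    d = 7 ^ s
    E = 49 ^ m
    F = 50 ^ m
    expand : ∀ x₁ x₂ b E → (x₁ + x₂) * (5 * (5 * b) * (49 * E)) ≡ 1225 * (x₁ * (b * E)) + 1225 * (x₂ * (b * E))
    expand = solve-∀
    collect : ∀ d F → 1225 * (d * F) + 1225 * (d * F) ≡ 7 * (7 * d) * (50 * F)
    collect = solve-∀

  -- A cycle (all degrees two): three branches of sizes s + 1, s and s + 1.
  Bound-cycle : ∀ s m x x₁ x₂ x₃ → x ≤ (x₁ + x₂) + x₃ → Bound (suc s) (suc m) x₁ → Bound s m x₂ → Bound (suc s) (suc m) x₃ →
    Bound (4 + s) (suc m) x
  Bound-cycle s m x x₁ x₂ x₃ x≤ h₁ h₂ h₃ = begin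
      x * (5 * (5 * (5 * (5 * b))) * (49 * E))   ≤⟨ *-monoˡ-≤ (5 * (5 * (5 * (5 * b))) * (49 * E)) x≤ ⟩
      ((x₁ + x₂) + x₃) * (5 * (5 * (5 * (5 * b))) * (49 * E))   ≡⟨ expand x₁ x₂ x₃ b E ⟩
      125 * (x₁ * (5 * b * (49 * E))) + 30625 * (x₂ * (b * E)) + 125 * (x₃ * (5 * b * (49 * E)))
                                                                           ≤⟨ +-mono-≤ (+-mono-≤ (*-monoʳ-≤ 125 h₁) (*-monoʳ-≤ 30625 h₂)) (*-monoʳ-≤ 125 h₃) ⟩
      125 * (7 * d * (50 * F)) + 30625 * (d * F) + 125 * (7 * d * (50 * F))  ≡⟨ collect d F ⟩
      118125 * (d * F)                                                     ≤⟨ *-monoˡ-≤ (d * F) (by-computation 118125 120050) ⟩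
      120050 * (d * F)                                                     ≡⟨ factor d F ⟩
      7 * (7 * (7 * (7 * d))) * (50 * F)                                   ∎
    where
    open ≤-Reasoning
    b = 5 ^ s
    d = 7 ^ s
    E = 49 ^ m
    F = 50 ^ m
    expand : ∀ x₁ x₂ x₃ b E → ((x₁ + x₂) + x₃) * (5 * (5 * (5 * (5 * b))) * (49 * E)) ≡
      125 * (x₁ * (5 * b * (49 * E))) + 30625 * (x₂ * (b * E)) + 125 * (x₃ * (5 * b * (49 * E)))
    expand = solve-∀
    collect : ∀ d F → 125 * (7 * d * (50 * F)) + 30625 * (d * F) + 125 * (7 * d * (50 * F)) ≡ 118125 * (d * F)
    collect = solve-∀
    factor : ∀ d F → 120050 * (d * F) ≡ 7 * (7 * (7 * (7 * d))) * (50 * F)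
    factor = solve-∀

  module _ {n : ℕ} (G : Graph n) where

    adj-sym : ∀ {x y} → adj G x y ≡ true → adj G y x ≡ true
    adj-sym {x} {y} xy = trans (Graph.sym G y x) xy
    adj-irrefl : ∀ {x y} → adj G x y ≡ true → x ≢ y
    adj-irrefl {x} xy refl = not-¬ xy (irref G x)

    N[_] : Fin n → VPred n
    N[ v ] x = (x == v) ∨ adj G v x
    N-self : ∀ u → N[ u ] u ≡ true
    N-self u rewrite ==-refl u = refl
    deg : VPred n → Fin n → ℕ
    deg W v = count (W ∩ adj G v)

    count-∖N : ∀ W v → W v ≡ true → count W ≡ suc (deg W v + count (W ∖ N[ v ]))
    count-∖N W v Wv = trans (count-split W N[ v ]) (cong (_+ count (W ∖ N[ v ])) closed≡1+open)
      where
      closed≡1+open : count (W ∩ N[ v ]) ≡ suc (deg W v)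
      closed≡1+open = count-insert (W ∩ adj G v) (W ∩ N[ v ]) v notOpen inClosed same
        where
        notOpen : (W ∩ adj G v) v ≡ false
        notOpen rewrite irref G v = ∧-zeroʳ (W v)
        inClosed : (W ∩ N[ v ]) v ≡ true
        inClosed rewrite ==-refl v | Wv = refl
        same : ∀ x → x ≢ v → (W ∩ adj G v) x ≡ (W ∩ N[ v ]) x
        same x x≢v rewrite ==-false x≢v = refl

    deg-zero : ∀ W v → deg W v ≡ 0 → ∀ x → W x ≡ true → adj G v x ≡ false
    deg-zero W v d≡0 x Wx = ¬-not λ vx → contradiction (subst (1 ≤_) d≡0 (count-≥1 (W ∩ adj G v) x (∧-intro Wx vx))) λ ()

    record UniqueNeighbour (W : VPred n) (v : Fin n) : Set where
      constructor uniqueNeighbour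
      field
        nbr : Fin n
        nbr∈W : W nbr ≡ true
        nbr-adj : adj G v nbr ≡ true
        nbr-unique : ∀ x → W x ≡ true → adj G v x ≡ true → x ≡ nbr
    deg-one : ∀ W v → deg W v ≡ 1 → UniqueNeighbour W v
    deg-one W v d≡1 with count-witness (W ∩ adj G v) (≤-reflexive (sym d≡1))
    ... | u , u∈ = uniqueNeighbour u (∧-conicalˡ _ _ u∈) (∧-conicalʳ (W u) _ u∈)
                     (λ x Wx vx → count-unique (W ∩ adj G v) d≡1 u∈ (∧-intro Wx vx))

    deg-remove : ∀ W v u → W v ≡ true → adj G u v ≡ true → deg W u ≡ suc (deg (W ∖ (_== v)) u)
    deg-remove W v u Wv uv = count-insert (W ∖ (_== v) ∩ adj G u) (W ∩ adj G u) v removed (∧-intro Wv uv) kept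
      where
      removed : (W ∖ (_== v) ∩ adj G u) v ≡ false
      removed rewrite ==-refl v | ∧-zeroʳ (W v) = refl
      kept : ∀ x → x ≢ v → (W ∖ (_== v) ∩ adj G u) x ≡ (W ∩ adj G u) x
      kept x x≢v rewrite ==-false x≢v | ∧-identityʳ (W x) = refl
    deg-remove-far : ∀ W v u → adj G u v ≡ false → deg (W ∖ (_== v)) u ≡ deg W u
    deg-remove-far W v u uv = count-cong _ _ same
      where
      same : ∀ x → (W ∖ (_== v) ∩ adj G u) x ≡ (W ∩ adj G u) x
      same x with x ≟ᶠ v
      ... | yes refl rewrite uv = trans (∧-zeroʳ _) (sym (∧-zeroʳ (W v)))
      ... | no x≢v = cong (_∧ adj G u x) (∧-identityʳ (W x))

    record IsMaximalIn (W : VPred n) (S : VSet n) : Set where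
      constructor maximal
      field
        inside : ∀ x → lookup S x ≡ true → W x ≡ true
        independent : ∀ x y → lookup S x ≡ true → lookup S y ≡ true → adj G x y ≡ false
        dominating : ∀ x → W x ≡ true → lookup S x ≡ false → ∃ λ y → lookup S y ≡ true × adj G y x ≡ true

    isMaximalIn? : ∀ W S → Dec (IsMaximalIn W S)
    isMaximalIn? W S = map′ (λ (i , d , m) → maximal i d m) (λ (maximal i d m) → i , d , m)
      (   all? (λ x → (lookup S x ≟ᵇ true) →-dec (W x ≟ᵇ true))
      ×-dec all? (λ x → all? λ y → (lookup S x ≟ᵇ true) →-dec ((lookup S y ≟ᵇ true) →-dec (adj G x y ≟ᵇ false)))
      ×-dec all? (λ x → (W x ≟ᵇ true) →-dec ((lookup S x ≟ᵇ false) →-dec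
                          any? (λ y → (lookup S y ≟ᵇ true) ×-dec (adj G y x ≟ᵇ true)))))

    misAt : VPred n → VSet n → ℕ
    misAt W S = 𝟙 (does (isMaximalIn? W S))
    misIn : VPred n → ℕ
    misIn W = sumAll (misAt W)

    misAt-map : ∀ W S W′ S′ → (IsMaximalIn W S → IsMaximalIn W′ S′) → misAt W S ≤ misAt W′ S′
    misAt-map W S W′ S′ f = 𝟙-mono (λ h → dec-true (isMaximalIn? W′ S′) (f (from-does (isMaximalIn? W S) h)))
    misAt-no : ∀ W S → ¬ IsMaximalIn W S → misAt W S ≡ 0
    misAt-no W S ¬mis rewrite dec-false (isMaximalIn? W S) ¬mis = refl

    isMaximalIndependent-sound : ∀ S → isMaximalIndependent G S ≡ true → IsMaximalIn (λ _ → true) S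
    isMaximalIndependent-sound S mis = maximal (λ _ _ → refl) indep dom
      where
      indep : ∀ x y → lookup S x ≡ true → lookup S y ≡ true → adj G x y ≡ false
      indep x y Sx Sy with all-tabulate⁻ _ id (all-tabulate⁻ _ id (∧-conicalˡ _ _ mis) x) y
      ... | noEdge rewrite Sx | Sy = not-injective noEdge
      dom : ∀ x → true ≡ true → lookup S x ≡ false → ∃ λ y → lookup S y ≡ true × adj G y x ≡ true
      dom x _ Sx with all-tabulate⁻ _ id (∧-conicalʳ (isIndependent G S) _ mis) x
      ... | cov rewrite Sx with any-tabulate⁻ _ id cov
      ... | y , yx = y , ∧-conicalˡ _ _ yx , ∧-conicalʳ (lookup S y) _ yx
    isMaximalIndependent-complete : ∀ S → IsMaximalIn (λ _ → true) S → isMaximalIndependent G S ≡ true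
    isMaximalIndependent-complete S (maximal _ indep dom) =
      ∧-intro (all-tabulate⁺ _ id (λ x → all-tabulate⁺ _ id (pairFree x))) (all-tabulate⁺ _ id covered)
      where
      pairFree : ∀ x y → not (lookup S x ∧ lookup S y ∧ adj G x y) ≡ true
      pairFree x y with lookup S x in Sx | lookup S y in Sy
      ... | false | _ = refl
      ... | true | false = refl
      ... | true | true rewrite indep x y Sx Sy = refl
      covered : ∀ x → (lookup S x ∨ any (λ u → lookup S u ∧ adj G u x) (allFin n)) ≡ true
      covered x with lookup S x in Sx
      ... | true = refl
      ... | false with dom x refl Sx
      ... | y , Sy , yx = any-tabulate⁺ _ id (y , trans (cong (_∧ adj G y x) Sy) yx)

    mis≡misIn : mis G ≡ misIn (λ _ → true)
    mis≡misIn = trans (countB-allSubsets (isMaximalIndependent G))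
                      (sumAll-cong _ _ (λ S → cong 𝟙 (does-unique _ (isMaximalIn? (λ _ → true) S)
                        (isMaximalIndependent-sound S) (isMaximalIndependent-complete S))))

    misIn-empty : ∀ W → (∀ x → W x ≡ false) → misIn W ≤ 1
    misIn-empty W empty = subst (misIn W ≤_) (sumAll-isEmpty {n}) (sumAll-mono (misAt W) (𝟙 ∘ isEmpty) onlyEmpty)
      where
      onlyEmpty : ∀ S → misAt W S ≤ 𝟙 (isEmpty S)
      onlyEmpty S = 𝟙-mono λ mis → isEmpty-intro S λ x → ¬-not λ Sx →
        not-¬ (IsMaximalIn.inside (from-does (isMaximalIn? W S) mis) x Sx) (empty x)

    undominated : ∀ W v S → W v ≡ true → lookup S v ≡ false →
      (∀ y → W y ≡ true → adj G v y ≡ true → lookup S y ≡ false) → ¬ IsMaximalIn W S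
    undominated W v S Wv Sv noNbr (maximal inside _ dom) with dom v Wv Sv
    ... | y , Sy , yv = not-¬ Sy (noNbr y (inside y Sy) (adj-sym yv))

    maximal-del : ∀ W v S → lookup S v ≡ false → IsMaximalIn W S → IsMaximalIn (W ∖ (_== v)) S
    maximal-del W v S Sv (maximal inside indep dom) = maximal inside′ indep dom′
      where
      inside′ : ∀ x → lookup S x ≡ true → (W ∖ (_== v)) x ≡ true
      inside′ x Sx = ∖-intro W (_== v) x (inside x Sx) (==-false (∉-≢ S v x Sv Sx))
      dom′ : ∀ x → (W ∖ (_== v)) x ≡ true → lookup S x ≡ false → ∃ λ y → lookup S y ≡ true × adj G y x ≡ true
      dom′ x Wx = dom x (∖-⊆ W (_== v) x Wx)

    maximal-∖N : ∀ W v S → lookup S v ≡ false → IsMaximalIn W (insert v S) → IsMaximalIn (W ∖ N[ v ]) S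
    maximal-∖N W v S Sv (maximal inside indep dom) = maximal inside′ indep′ dom′
      where
      grow : ∀ x → lookup S x ≡ true → lookup (insert v S) x ≡ true
      grow x Sx = trans (insert-keeps v x S (∉-≢ S v x Sv Sx)) Sx
      inside′ : ∀ x → lookup S x ≡ true → (W ∖ N[ v ]) x ≡ true
      inside′ x Sx = ∖-intro W N[ v ] x (inside x (grow x Sx))
        (cong₂ _∨_ (==-false (∉-≢ S v x Sv Sx)) (indep v x (insert-∈ v S) (grow x Sx)))
      indep′ : ∀ x y → lookup S x ≡ true → lookup S y ≡ true → adj G x y ≡ false
      indep′ x y Sx Sy = indep x y (grow x Sx) (grow y Sy)
      dom′ : ∀ x → (W ∖ N[ v ]) x ≡ true → lookup S x ≡ false → ∃ λ y → lookup S y ≡ true × adj G y x ≡ true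
      dom′ x Wx Sx with dom x (∖-⊆ W N[ v ] x Wx) (trans (insert-keeps v x S x≢v) Sx)
        where x≢v = λ x≡v → not-¬ (==-true x≡v) (∨-conicalˡ _ _ (∖-∉ W N[ v ] x Wx))
      ... | y , S′y , yx with y ≟ᶠ v
      ... | yes refl = ⊥-elim (not-¬ yx (∨-conicalʳ (x == v) _ (∖-∉ W N[ v ] x Wx)))
      ... | no y≢v = y , trans (sym (insert-keeps v y S y≢v)) S′y , yx

    misIn-branch : ∀ W v → misIn W ≤ misIn (W ∖ (_== v)) + misIn (W ∖ N[ v ])
    misIn-branch W v = sumAll-branch v (misAt W) (misAt (W ∖ (_== v))) (misAt (W ∖ N[ v ])) λ S Sv →
      +-mono-≤ (misAt-map W S _ S (maximal-del W v S Sv)) (misAt-map W (insert v S) _ S (maximal-∖N W v S Sv))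

    -- An isolated vertex of W lies in every maximal independent set of G[W].
    misIn-isolated : ∀ W v → W v ≡ true → (∀ x → W x ≡ true → adj G v x ≡ false) → misIn W ≤ misIn (W ∖ N[ v ])
    misIn-isolated W v Wv isolated = subst (misIn W ≤_) (cong (_+ misIn (W ∖ N[ v ])) (sumAll-zero {n}))
      (sumAll-branch v (misAt W) (λ _ → 0) (misAt (W ∖ N[ v ])) λ S Sv →
        subst (_≤ misAt (W ∖ N[ v ]) S) (sym (cong (_+ misAt W (insert v S)) (misAt-no W S (notMaximal S Sv))))
              (misAt-map W (insert v S) _ S (maximal-∖N W v S Sv)))
      where
      notMaximal : ∀ S → lookup S v ≡ false → ¬ IsMaximalIn W S
      notMaximal S Sv = undominated W v S Wv Sv λ y Wy vy → contradiction (isolated y Wy) (not-¬ vy)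

    -- For a pendant vertex v of W with neighbour u, every maximal independent
    -- set of G[W] contains exactly one of u and v.
    misIn-pendant : ∀ W u v → W v ≡ true → adj G u v ≡ true → (∀ x → W x ≡ true → adj G v x ≡ true → x ≡ u) →
      misIn W ≤ misIn (W ∖ N[ v ]) + misIn (W ∖ N[ u ])
    misIn-pendant W u v Wv uv pendant = sumAll-branch₂ u v u≢v (misAt W) (misAt (W ∖ N[ v ])) (misAt (W ∖ N[ u ])) quad≤
      where
      u≢v = adj-irrefl uv
      -- Containing neither of u, v leaves v undominated; containing both is not independent.
      neither : ∀ S → lookup S u ≡ false → lookup S v ≡ false → ¬ IsMaximalIn W S
      neither S Su Sv = undominated W v S Wv Sv λ y Wy vy → subst (λ z → lookup S z ≡ false) (sym (pendant y Wy vy)) Su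
      both : ∀ S → ¬ IsMaximalIn W (insert v (insert u S))
      both S (maximal _ indep _) =
        not-¬ uv (indep u v (trans (insert-keeps v u (insert u S) u≢v) (insert-∈ u S)) (insert-∈ v (insert u S)))
      quad≤ : ∀ S → lookup S u ≡ false → lookup S v ≡ false →
        (misAt W S + misAt W (insert v S)) + (misAt W (insert u S) + misAt W (insert v (insert u S)))
          ≤ misAt (W ∖ N[ v ]) S + misAt (W ∖ N[ u ]) S
      quad≤ S Su Sv rewrite misAt-no W S (neither S Su Sv) | misAt-no W (insert v (insert u S)) (both S)
                          | +-identityʳ (misAt W (insert u S)) =
        +-mono-≤ (misAt-map W (insert v S) _ S (maximal-∖N W v S Sv)) (misAt-map W (insert u S) _ S (maximal-∖N W u S Su))

    InducesMatching : VSet n → Set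
    InducesMatching U = ∀ w → lookup U w ≡ true → count (lookup U ∩ adj G w) ≡ 1

    isInducedMatching-sound : ∀ U → isInducedMatching G U ≡ true → InducesMatching U
    isInducedMatching-sound U isIM w Uw with all-tabulate⁻ _ id isIM w
    ... | holds rewrite Uw = ≡ᵇ⇒≡ _ 1 (subst T (cong (_≡ᵇ 1) (countB-tabulate (λ x → lookup U x ∧ adj G w x) id)) (T-≡ .from holds))
    isInducedMatching-complete : ∀ U → InducesMatching U → isInducedMatching G U ≡ true
    isInducedMatching-complete U match = all-tabulate⁺ _ id holds
      where
      holds : ∀ w → (not (lookup U w) ∨ (countB (λ v → lookup U v ∧ adj G w v) (allFin n) ≡ᵇ 1)) ≡ true
      holds w with lookup U w in Uw
      ... | false = refl
      ... | true = trans (cong (_≡ᵇ 1) (countB-tabulate (λ x → lookup U x ∧ adj G w x) id)) (T-≡ .to (≡⇒≡ᵇ _ 1 (match w Uw)))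

    module _ (U : VSet n) (u v : Fin n) (uv : adj G u v ≡ true) (Uu : lookup U u ≡ false) (Uv : lookup U v ≡ false)
             (far : ∀ x → lookup U x ≡ true → adj G u x ≡ false × adj G v x ≡ false) where

      private
        U₂ : VSet n
        U₂ = insert v (insert u U)

        lookup-U₂ : ∀ x → lookup U₂ x ≡ (x == v) ∨ ((x == u) ∨ lookup U x)
        lookup-U₂ x = trans (lookup-insert v x (insert u U)) (cong ((x == v) ∨_) (lookup-insert u x U))

        partner-of-v : ∀ x → (lookup U₂ x ∧ adj G v x) ≡ (x == u)
        partner-of-v x rewrite lookup-U₂ x with x ≟ᶠ v | x ≟ᶠ u
        ... | yes refl | yes refl = ⊥-elim (adj-irrefl uv refl)
        ... | yes refl | no _ = irref G v
        ... | no _ | yes refl = adj-sym uv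
        ... | no _ | no _ with lookup U x in Ux
        ... | false = refl
        ... | true = proj₂ (far x Ux)
        partner-of-u : ∀ x → (lookup U₂ x ∧ adj G u x) ≡ (x == v)
        partner-of-u x rewrite lookup-U₂ x with x ≟ᶠ v | x ≟ᶠ u
        ... | yes refl | _ = uv
        ... | no _ | yes refl = irref G u
        ... | no _ | no _ with lookup U x in Ux
        ... | false = refl
        ... | true = proj₁ (far x Ux)

        old-neighbours : ∀ w → lookup U w ≡ true → ∀ x → (lookup U₂ x ∧ adj G w x) ≡ (lookup U x ∧ adj G w x)
        old-neighbours w Uw x rewrite lookup-U₂ x with x ≟ᶠ v | x ≟ᶠ u
        ... | yes refl | _ rewrite Uv = trans (Graph.sym G w v) (proj₂ (far w Uw))
        ... | no _ | yes refl rewrite Uu = trans (Graph.sym G w u) (proj₁ (far w Uw))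
        ... | no _ | no _ = refl

      InducesMatching-extend : InducesMatching U → InducesMatching (insert v (insert u U))
      InducesMatching-extend matchU w U₂w with w ≟ᶠ v | w ≟ᶠ u
      ... | yes refl | _ = trans (count-cong _ (_== u) partner-of-v) (count-singleton u)
      ... | no _ | yes refl = trans (count-cong _ (_== v) partner-of-u) (count-singleton v)
      ... | no w≢v | no w≢u = trans (count-cong _ _ (old-neighbours w Uw)) (matchU w Uw)
        where
        Uw : lookup U w ≡ true
        Uw = trans (sym (trans (lookup-U₂ w) (cong₂ _∨_ (==-false w≢v) (cong (_∨ lookup U w) (==-false w≢u))))) U₂w

    _⊆?_ : (U : VSet n) (W : VPred n) → Dec (∀ x → lookup U x ≡ true → W x ≡ true)
    U ⊆? W = all? (λ x → (lookup U x ≟ᵇ true) →-dec (W x ≟ᵇ true))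

    matchingValue : VPred n → VSet n → ℕ
    matchingValue W U = if does (U ⊆? W) ∧ isInducedMatching G U then size G U else 0
    imIn : VPred n → ℕ
    imIn W = maxOver (matchingValue W) (allSubsets n)

    im≡imIn : im G ≡ imIn (λ _ → true)
    im≡imIn = maxOver-cong _ _ (allSubsets n) λ U →
      cong (λ b → if b ∧ isInducedMatching G U then size G U else 0) (sym (dec-true (U ⊆? (λ _ → true)) λ _ _ → refl))

    imIn-≥ : ∀ W U → (∀ x → lookup U x ≡ true → W x ≡ true) → InducesMatching U → size G U ≤ imIn W
    imIn-≥ W U U⊆W match = subst (_≤ imIn W) value≡size (maxOver-≥ (matchingValue W) (allSubsets n) U (allSubsets-complete U))
      where
      value≡size : matchingValue W U ≡ size G U
      value≡size = cong (λ b → if b then size G U else 0) (cong₂ _∧_ (dec-true (U ⊆? W) U⊆W) (isInducedMatching-complete U match))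

    imIn-mono : ∀ W W′ → (∀ x → W′ x ≡ true → W x ≡ true) → imIn W′ ≤ imIn W
    imIn-mono W W′ W′⊆W = maxOver-≤ (matchingValue W′) (allSubsets n) (imIn W) bounded
      where
      bounded : ∀ U → matchingValue W′ U ≤ imIn W
      bounded U with does (U ⊆? W′) in sub | isInducedMatching G U in isIM
      ... | false | _ = z≤n
      ... | true | false = z≤n
      ... | true | true = imIn-≥ W U (λ x Ux → W′⊆W x (from-does (U ⊆? W′) sub x Ux)) (isInducedMatching-sound U isIM)

    size≡count/2 : ∀ U → size G U ≡ count (lookup U) / 2
    size≡count/2 U = cong (_/ 2) (countB-tabulate (lookup U) id)

    size-insert₂ : ∀ U u v → u ≢ v → lookup U u ≡ false → lookup U v ≡ false →
      size G (insert v (insert u U)) ≡ suc (size G U)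
    size-insert₂ U u v u≢v Uu Uv rewrite size≡count/2 (insert v (insert u U)) | size≡count/2 U
      | count-insert-∉ v (insert u U) (trans (insert-keeps u v U (u≢v ∘ sym)) Uv) | count-insert-∉ u U Uu =
      m/n≡1+[m∸n]/n {2 + count (lookup U)} {2} (s≤s (s≤s z≤n))

    -- For a pendant vertex v of W with neighbour u, the edge uv extends every
    -- induced matching of G[W ∖ N[u]]; hence im(G[W ∖ N[u]]) < im(G[W]).
    imIn-pendant : ∀ W u v → W u ≡ true → W v ≡ true → adj G u v ≡ true →
      (∀ x → W x ≡ true → adj G v x ≡ true → x ≡ u) → suc (imIn (W ∖ N[ u ])) ≤ imIn W
    imIn-pendant W u v Wu Wv uv pendant =
      maxOver-< (matchingValue (W ∖ N[ u ])) (allSubsets n) (imIn W) imIn-positive below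
      where
      extend : ∀ U → (∀ x → lookup U x ≡ true → (W ∖ N[ u ]) x ≡ true) → InducesMatching U → suc (size G U) ≤ imIn W
      extend U sub match = subst (_≤ imIn W) (size-insert₂ U u v (adj-irrefl uv) (outside u (N-self u)) (outside v Nv))
        (imIn-≥ W (insert v (insert u U)) sub₂ (InducesMatching-extend U u v uv (outside u (N-self u)) (outside v Nv) far match))
        where
        outside : ∀ y → N[ u ] y ≡ true → lookup U y ≡ false
        outside y Ny = ¬-not λ Uy → not-¬ Ny (∖-∉ W N[ u ] y (sub y Uy))
        Nv : N[ u ] v ≡ true
        Nv rewrite uv = ∨-zeroʳ (v == u)
        far : ∀ x → lookup U x ≡ true → adj G u x ≡ false × adj G v x ≡ false
        far x Ux = ∨-conicalʳ (x == u) _ (∖-∉ W N[ u ] x (sub x Ux)) ,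
                   ¬-not λ vx → not-¬ (subst (λ y → lookup U y ≡ true) (pendant x (∖-⊆ W N[ u ] x (sub x Ux)) vx) Ux)
                                     (outside u (N-self u))
        sub₂ : ∀ x → lookup (insert v (insert u U)) x ≡ true → W x ≡ true
        sub₂ x U₂x with x ≟ᶠ v | x ≟ᶠ u
        ... | yes refl | _ = Wv
        ... | no _ | yes refl = Wu
        ... | no x≢v | no x≢u =
          ∖-⊆ W N[ u ] x (sub x (trans (sym (trans (insert-keeps v x (insert u U) x≢v) (insert-keeps u x U x≢u))) U₂x))
      -- The empty matching extends to the single edge uv.
      imIn-positive : 0 < imIn W
      imIn-positive = ≤-trans (s≤s z≤n) (extend (replicate n false) (λ x ∅x → ⊥-elim (not-¬ ∅x (lookup-replicate x false)))
                                                                   (λ w ∅w → ⊥-elim (not-¬ ∅w (lookup-replicate w false))))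
      below : ∀ U → matchingValue (W ∖ N[ u ]) U < imIn W
      below U with does (U ⊆? (W ∖ N[ u ])) in sub | isInducedMatching G U in isIM
      ... | true | true = extend U (from-does (U ⊆? (W ∖ N[ u ])) sub) (isInducedMatching-sound U isIM)
      ... | true | false = imIn-positive
      ... | false | _ = imIn-positive

    module _ (triangleFree : TriangleFree G) where

      MisBound : VPred n → Set
      MisBound W = Bound (count W) (imIn W) (misIn W)

      BoundedUpTo : ℕ → Set
      BoundedUpTo t = ∀ W → count W ≤ t → MisBound W

      hypothesis : ∀ {t} → BoundedUpTo t → ∀ W′ {s m} → count W′ ≡ s → s ≤ t → imIn W′ ≤ m → Bound s m (misIn W′)
      hypothesis IH W′ refl s≤t im≤m = Bound-raise (count W′) (imIn W′) _ (misIn W′) im≤m (IH W′ s≤t)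

      conclude : ∀ W {s m} → count W ≡ s → imIn W ≡ m → Bound s m (misIn W) → MisBound W
      conclude W refl refl bound = bound

      ≡suc-pred : ∀ {a b} → suc a ≤ b → b ≡ suc (pred b)
      ≡suc-pred {b = suc b} _ = refl

      imIn-∖ : ∀ W N → imIn (W ∖ N) ≤ imIn W
      imIn-∖ W N = imIn-mono W (W ∖ N) (∖-⊆ W N)

      case-isolated : ∀ t → BoundedUpTo t → ∀ W → count W ≤ suc t → ∀ v → W v ≡ true → deg W v ≡ 0 → MisBound W
      case-isolated t IH W |W|≤ v Wv deg≡0 =
        conclude W |W|≡ refl (Bound-isolated s (imIn W) (misIn W) _ (misIn-isolated W v Wv (deg-zero W v deg≡0))
          (hypothesis IH (W ∖ N[ v ]) refl (≤-pred (subst (_≤ suc t) |W|≡ |W|≤)) (imIn-∖ W N[ v ])))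
        where
        s = count (W ∖ N[ v ])
        |W|≡ : count W ≡ suc s
        |W|≡ = trans (count-∖N W v Wv) (cong (λ d → suc (d + s)) deg≡0)

      case-branch : ∀ t → BoundedUpTo t → ∀ W → count W ≤ suc t → ∀ v → W v ≡ true → 3 ≤ deg W v → MisBound W
      case-branch t IH W |W|≤ v Wv 3≤k =
        conclude W (count-∖N W v Wv) refl
          (Bound-branch k s (imIn W) (misIn W) (misIn (W ∖ (_== v))) (misIn (W ∖ N[ v ])) 3≤k (misIn-branch W v)
            (hypothesis IH (W ∖ (_== v)) |W−v|≡ k+s≤t (imIn-∖ W (_== v)))
            (hypothesis IH (W ∖ N[ v ]) refl (≤-trans (m≤n+m s k) k+s≤t) (imIn-∖ W N[ v ])))
        where
        k = deg W v
        s = count (W ∖ N[ v ])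
        |W−v|≡ : count (W ∖ (_== v)) ≡ k + s
        |W−v|≡ = suc-injective (trans (sym (count-remove W v Wv)) (count-∖N W v Wv))
        k+s≤t : k + s ≤ t
        k+s≤t = ≤-pred (subst (_≤ suc t) (trans (count-remove W v Wv) (cong suc |W−v|≡)) |W|≤)

      module PendantCase (t : ℕ) (IH : BoundedUpTo t) (W : VPred n) (|W|≤ : count W ≤ suc t)
                         (v : Fin n) (Wv : W v ≡ true) (deg≡1 : deg W v ≡ 1) where
        open UniqueNeighbour (deg-one W v deg≡1) public renaming (nbr to u; nbr∈W to Wu; nbr-adj to vu; nbr-unique to pendant)
        uv = adj-sym vu
        s = count (W ∖ N[ u ])
        |W|≡ᵥ : count W ≡ suc (suc (count (W ∖ N[ v ])))
        |W|≡ᵥ = trans (count-∖N W v Wv) (cong (λ d → suc (d + count (W ∖ N[ v ]))) deg≡1)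
        im-drop : suc (imIn (W ∖ N[ u ])) ≤ imIn W
        im-drop = imIn-pendant W u v Wu Wv uv pendant
        M = pred (imIn W)
        im≡ : imIn W ≡ suc M
        im≡ = ≡suc-pred im-drop
        im≤M : imIn (W ∖ N[ u ]) ≤ M
        im≤M = ≤-pred (subst (suc (imIn (W ∖ N[ u ])) ≤_) im≡ im-drop)

        -- uv is an isolated edge: u is pendant as well, so uv also extends the matchings of W ∖ N[v].
        isolated-edge : deg W u ≡ 1 → MisBound W
        isolated-edge degᵤ≡1 =
          conclude W |W|≡ im≡ (Bound-pendant-edge s M (misIn W) (misIn (W ∖ N[ v ])) (misIn (W ∖ N[ u ]))
            (misIn-pendant W u v Wv uv pendant)
            (hypothesis IH (W ∖ N[ v ]) |Wᵥ|≡ s≤t (≤-pred (subst (suc (imIn (W ∖ N[ v ])) ≤_) im≡ im-dropᵥ)))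
            (hypothesis IH (W ∖ N[ u ]) refl s≤t im≤M))
          where
          |W|≡ : count W ≡ 2 + s
          |W|≡ = trans (count-∖N W u Wu) (cong (λ d → suc (d + s)) degᵤ≡1)
          |Wᵥ|≡ : count (W ∖ N[ v ]) ≡ s
          |Wᵥ|≡ = suc-injective (suc-injective (trans (sym |W|≡ᵥ) |W|≡))
          s≤t : s ≤ t
          s≤t = ≤-pred (≤-trans (n≤1+n _) (subst (_≤ suc t) |W|≡ |W|≤))
          pendantᵤ : ∀ x → W x ≡ true → adj G u x ≡ true → x ≡ v
          pendantᵤ x Wx ux = trans (nbr-unique x Wx ux) (sym (nbr-unique v Wv uv))
            where open UniqueNeighbour (deg-one W u degᵤ≡1)
          im-dropᵥ : suc (imIn (W ∖ N[ v ])) ≤ imIn W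
          im-dropᵥ = imIn-pendant W v u Wv Wu vu pendantᵤ

        long-pendant : ∀ k′ → deg W u ≡ suc (suc k′) → MisBound W
        long-pendant k′ degᵤ≡ =
          conclude W |W|≡ im≡ (Bound-pendant (suc k′) s M (misIn W) (misIn (W ∖ N[ v ])) (misIn (W ∖ N[ u ]))
            (s≤s z≤n) (misIn-pendant W u v Wv uv pendant)
            (hypothesis IH (W ∖ N[ v ]) |Wᵥ|≡ k+s≤t (subst (imIn (W ∖ N[ v ]) ≤_) im≡ (imIn-∖ W N[ v ])))
            (hypothesis IH (W ∖ N[ u ]) refl (≤-trans (m≤n+m s (suc k′)) k+s≤t) im≤M))
          where
          |W|≡ : count W ≡ 2 + (suc k′ + s)
          |W|≡ = trans (count-∖N W u Wu) (cong (λ d → suc (d + s)) degᵤ≡)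
          |Wᵥ|≡ : count (W ∖ N[ v ]) ≡ suc k′ + s
          |Wᵥ|≡ = suc-injective (suc-injective (trans (sym |W|≡ᵥ) |W|≡))
          k+s≤t : suc k′ + s ≤ t
          k+s≤t = ≤-pred (≤-trans (n≤1+n _) (subst (_≤ suc t) |W|≡ |W|≤))

      case-pendant : ∀ t → BoundedUpTo t → ∀ W → count W ≤ suc t → ∀ v → W v ≡ true → deg W v ≡ 1 → MisBound W
      case-pendant t IH W |W|≤ v Wv deg≡1 = by-degree-of-u (deg W u) refl
        where
        open PendantCase t IH W |W|≤ v Wv deg≡1
        by-degree-of-u : ∀ k → deg W u ≡ k → MisBound W
        by-degree-of-u zero degᵤ≡0 = contradiction (deg-zero W u degᵤ≡0 v Wv) (not-¬ uv)
        by-degree-of-u (suc zero) degᵤ≡1 = isolated-edge degᵤ≡1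
        by-degree-of-u (suc (suc k′)) degᵤ≡ = long-pendant k′ degᵤ≡

      -- Two steps from v₀ in a set W where all degrees are 2: a neighbour u of v₀ is
      -- pendant in W − v₀, with neighbour x, and x keeps degree 2 there as x ≁ v₀.
      record TwoStepPath (W : VPred n) (v₀ : Fin n) : Set where
        field
          u x : Fin n
          W₁u : (W ∖ (_== v₀)) u ≡ true
          W₁x : (W ∖ (_== v₀)) x ≡ true
          ux : adj G u x ≡ true
          pendant : ∀ y → (W ∖ (_== v₀)) y ≡ true → adj G u y ≡ true → y ≡ x
          deg-u : deg (W ∖ (_== v₀)) u ≡ 1
          deg-x : deg (W ∖ (_== v₀)) x ≡ 2
      two-step-path : ∀ W → (∀ v → W v ≡ true → deg W v ≡ 2) → ∀ v₀ → W v₀ ≡ true → TwoStepPath W v₀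
      two-step-path W two v₀ Wv₀ with count-witness (W ∩ adj G v₀) (subst (1 ≤_) (sym (two v₀ Wv₀)) (s≤s z≤n))
      ... | u , u∈ = record { u = u ; x = x ; W₁u = W₁u ; W₁x = W₁x ; ux = ux ; pendant = pendant ; deg-u = deg-u
                            ; deg-x = trans (deg-remove-far W v₀ x x≁v₀) (two x (∖-⊆ W (_== v₀) x W₁x)) }
        where
        Wu = ∧-conicalˡ _ _ u∈
        v₀u = ∧-conicalʳ (W u) _ u∈
        W₁u = ∖-intro W (_== v₀) u Wu (==-false (adj-irrefl v₀u ∘ sym))
        deg-u = suc-injective (trans (sym (deg-remove W v₀ u Wv₀ (adj-sym v₀u))) (two u Wu))
        open UniqueNeighbour (deg-one (W ∖ (_== v₀)) u deg-u) renaming (nbr to x; nbr∈W to W₁x; nbr-adj to ux; nbr-unique to pendant)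
        x≁v₀ : adj G x v₀ ≡ false
        x≁v₀ = ¬-not λ xv₀ → triangleFree v₀ u x v₀u ux (adj-sym xv₀)

      -- Every vertex of W has degree 2.  Branch on v₀, then on the pendant vertex u of W − v₀.
      case-cycle : ∀ t → BoundedUpTo t → ∀ W → count W ≤ suc t → (∀ v → W v ≡ true → deg W v ≡ 2) →
        ∀ v₀ → W v₀ ≡ true → MisBound W
      case-cycle t IH W |W|≤ two v₀ Wv₀ =
        conclude W |W|≡ im≡ (Bound-cycle s M (misIn W) (misIn A) (misIn B) (misIn C) mis≤
          (hypothesis IH A |A|≡ s+1≤t (subst (imIn A ≤_) im≡ (≤-trans (imIn-∖ W₁ N[ u ]) (imIn-∖ W (_== v₀)))))
          (hypothesis IH B refl (≤-trans (n≤1+n s) s+1≤t) imB≤M)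
          (hypothesis IH C |C|≡ s+1≤t (subst (imIn C ≤_) im≡ (imIn-∖ W N[ v₀ ]))))
        where
        open TwoStepPath (two-step-path W two v₀ Wv₀)
        W₁ = W ∖ (_== v₀)
        A = W₁ ∖ N[ u ]
        B = W₁ ∖ N[ x ]
        C = W ∖ N[ v₀ ]
        s = count B
        mis≤ : misIn W ≤ (misIn A + misIn B) + misIn C
        mis≤ = ≤-trans (misIn-branch W v₀) (+-monoˡ-≤ (misIn C) (misIn-pendant W₁ x u W₁u (adj-sym ux) pendant))
        |W₁|≡ : count W₁ ≡ 3 + s
        |W₁|≡ = trans (count-∖N W₁ x W₁x) (cong (λ d → suc (d + s)) deg-x)
        |W|≡ : count W ≡ 4 + s
        |W|≡ = trans (count-remove W v₀ Wv₀) (cong suc |W₁|≡)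
        |A|≡ : count A ≡ suc s
        |A|≡ = suc-injective (suc-injective (trans (sym (trans (count-∖N W₁ u W₁u) (cong (λ d → suc (d + count A)) deg-u))) |W₁|≡))
        |C|≡ : count C ≡ suc s
        |C|≡ = suc-injective (suc-injective (suc-injective
                 (trans (sym (trans (count-∖N W v₀ Wv₀) (cong (λ d → suc (d + count C)) (two v₀ Wv₀)))) |W|≡)))
        s+1≤t : suc s ≤ t
        s+1≤t = ≤-pred (≤-trans (n≤1+n _) (≤-trans (n≤1+n _) (subst (_≤ suc t) |W|≡ |W|≤)))
        im-drop : suc (imIn B) ≤ imIn W
        im-drop = ≤-trans (imIn-pendant W₁ x u W₁x W₁u (adj-sym ux) pendant) (imIn-∖ W (_== v₀))
        M = pred (imIn W)
        im≡ : imIn W ≡ suc M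
        im≡ = ≡suc-pred im-drop
        imB≤M : imIn B ≤ M
        imB≤M = ≤-pred (subst (suc (imIn B) ≤_) im≡ im-drop)

      misBoundUpTo : ∀ t → BoundedUpTo t
      misBoundUpTo t W |W|≤ with any? (λ v → W v ≟ᵇ true)
      ... | no noVertex = conclude W (count-none W outside) refl (Bound-empty (imIn W) (misIn W) (misIn-empty W outside))
        where
        outside : ∀ x → W x ≡ false
        outside x = ¬-not λ Wx → noVertex (x , Wx)
      misBoundUpTo zero W |W|≤ | yes (v₀ , Wv₀) = contradiction (≤-trans (count-≥1 W v₀ Wv₀) |W|≤) λ ()
      misBoundUpTo (suc t) W |W|≤ | yes (v₀ , Wv₀)
        with any? (λ v → (W v ≟ᵇ true) ×-dec (deg W v ≟ 0))
      ... | yes (v , Wv , d≡0) = case-isolated t (misBoundUpTo t) W |W|≤ v Wv d≡0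
      ... | no noIsolated with any? (λ v → (W v ≟ᵇ true) ×-dec (deg W v ≟ 1))
      ... | yes (v , Wv , d≡1) = case-pendant t (misBoundUpTo t) W |W|≤ v Wv d≡1
      ... | no noPendant with any? (λ v → (W v ≟ᵇ true) ×-dec (3 ≤? deg W v))
      ... | yes (v , Wv , 3≤d) = case-branch t (misBoundUpTo t) W |W|≤ v Wv 3≤d
      ... | no noHigh = case-cycle t (misBoundUpTo t) W |W|≤ allTwo v₀ Wv₀
        where
        allTwo : ∀ v → W v ≡ true → deg W v ≡ 2
        allTwo v Wv with deg W v in d≡
        ... | 0 = contradiction (v , Wv , d≡) noIsolated
        ... | 1 = contradiction (v , Wv , d≡) noPendant
        ... | 2 = refl
        ... | suc (suc (suc _)) = contradiction (v , Wv , subst (3 ≤_) (sym d≡) (s≤s (s≤s (s≤s z≤n)))) noHigh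

      mis-bound : mis G * (5 ^ n * 49 ^ im G) ≤ 7 ^ n * 50 ^ im G
      mis-bound rewrite mis≡misIn | im≡imIn =
        subst (λ s → Bound s (imIn (λ _ → true)) (misIn (λ _ → true))) (count-all n) (misBoundUpTo _ (λ _ → true) ≤-refl)
        where
        count-all : ∀ m → count {m} (λ _ → true) ≡ m
        count-all zero = refl
        count-all (suc m) = cong suc (count-all m)

  ^-distribʳ-* : ∀ a b k → (a * b) ^ k ≡ a ^ k * b ^ k
  ^-distribʳ-* a b zero = refl
  ^-distribʳ-* a b (suc k) rewrite ^-distribʳ-* a b k = shuffle a b (a ^ k) (b ^ k)
    where
    shuffle : ∀ a b x y → a * b * (x * y) ≡ a * x * (b * y)
    shuffle = solve-∀

  suc^-nonZero : ∀ m k → NonZero (suc m ^ k)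
  suc^-nonZero m k = m^n≢0 (suc m) k

  2^-cancel-≤ : ∀ a b → 2 ^ a ≤ 2 ^ b → a ≤ b
  2^-cancel-≤ a b 2^a≤2^b with b <? a
  ... | yes b<a = contradiction 2^a≤2^b (<⇒≱ (^-monoʳ-< 2 (s≤s (s≤s z≤n)) b<a))
  ... | no b≮a = ≮⇒≥ b≮a

  -- With n = 2m + d, the main bound X ≤ (7/5)ⁿ (50/49)^m says X ≤ 2^m (7/5)^d,
  -- since (7/5)² · 50/49 = 2.
  halve : ∀ X m d → X * (5 ^ (m + m + d) * 49 ^ m) ≤ 7 ^ (m + m + d) * 50 ^ m → X * 5 ^ d ≤ 7 ^ d * 2 ^ m
  halve X m d bound = *-cancelˡ-≤ K {{K≢0}} (subst₂ _≤_ (regroupˡ X a b c) (regroupʳ a c g t) bound′)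
    where
    a = 5 ^ m
    b = 5 ^ d
    c = 7 ^ m
    g = 7 ^ d
    t = 2 ^ m
    K = a * a * (c * c)
    K≢0 : NonZero K
    K≢0 = m*n≢0 (a * a) (c * c) {{m*n≢0 a a {{suc^-nonZero 4 m}} {{suc^-nonZero 4 m}}}}
                                {{m*n≢0 c c {{suc^-nonZero 6 m}} {{suc^-nonZero 6 m}}}}
    5^n : 5 ^ (m + m + d) ≡ a * a * b
    5^n rewrite ^-distribˡ-+-* 5 (m + m) d | ^-distribˡ-+-* 5 m m = refl
    7^n : 7 ^ (m + m + d) ≡ c * c * g
    7^n rewrite ^-distribˡ-+-* 7 (m + m) d | ^-distribˡ-+-* 7 m m = refl
    50^m : 50 ^ m ≡ a * a * t
    50^m = trans (^-distribʳ-* 25 2 m) (cong (_* t) (^-distribʳ-* 5 5 m))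
    bound′ : X * (a * a * b * (c * c)) ≤ c * c * g * (a * a * t)
    bound′ = subst₂ _≤_ (cong₂ (λ u v → X * (u * v)) 5^n (^-distribʳ-* 7 7 m)) (cong₂ _*_ 7^n 50^m) bound
    regroupˡ : ∀ X a b c → X * (a * a * b * (c * c)) ≡ a * a * (c * c) * (X * b)
    regroupˡ = solve-∀
    regroupʳ : ∀ a c g t → c * c * g * (a * a * t) ≡ a * a * (c * c) * (g * t)
    regroupʳ = solve-∀

  square : ∀ X m d → X * 5 ^ d ≤ 7 ^ d * 2 ^ m → X * X * 50 ^ d ≤ 49 ^ d * 2 ^ (m + m + d)
  square X m d bound = subst₂ _≤_ (sym lhs) (sym rhs) (*-monoˡ-≤ (2 ^ d) (*-mono-≤ bound bound))
    where
    b = 5 ^ d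
    g = 7 ^ d
    t = 2 ^ m
    s = 2 ^ d
    lhs : X * X * 50 ^ d ≡ X * b * (X * b) * s
    lhs rewrite ^-distribʳ-* 25 2 d | ^-distribʳ-* 5 5 d = regroup X b s
      where
      regroup : ∀ X b s → X * X * (b * b * s) ≡ X * b * (X * b) * s
      regroup = solve-∀
    rhs : 49 ^ d * 2 ^ (m + m + d) ≡ g * t * (g * t) * s
    rhs rewrite ^-distribʳ-* 7 7 d | ^-distribˡ-+-* 2 (m + m) d | ^-distribˡ-+-* 2 m m = regroup g t s
      where
      regroup : ∀ g t s → g * g * (t * t * s) ≡ g * t * (g * t) * s
      regroup = solve-∀

  -- Since 2 · 49⁵⁰ ≤ 50⁵⁰, the 50th power gives X¹⁰⁰ · 2^d ≤ 2^(50n).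
  to-powers-of-two : ∀ X n d → X * X * 50 ^ d ≤ 49 ^ d * 2 ^ n → X ^ 100 * 2 ^ d ≤ 2 ^ (50 * n)
  to-powers-of-two X n d bound = *-cancelˡ-≤ (49 ^ (d * 50)) {{suc^-nonZero 48 (d * 50)}} (begin
      49 ^ (d * 50) * (X ^ 100 * 2 ^ d)      ≡⟨ regroup (49 ^ (d * 50)) (X ^ 100) (2 ^ d) ⟩
      X ^ 100 * (2 ^ d * 49 ^ (d * 50))      ≤⟨ *-monoʳ-≤ (X ^ 100) decay ⟩
      X ^ 100 * 50 ^ (d * 50)                ≡⟨ sym lhs ⟩
      (X * X * 50 ^ d) ^ 50                  ≤⟨ ^-monoˡ-≤ 50 bound ⟩
      (49 ^ d * 2 ^ n) ^ 50                  ≡⟨ rhs ⟩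
      49 ^ (d * 50) * 2 ^ (50 * n)           ∎)
    where
    open ≤-Reasoning
    decay : 2 ^ d * 49 ^ (d * 50) ≤ 50 ^ (d * 50)
    decay = subst₂ _≤_ (trans (^-distribʳ-* 2 (49 ^ 50) d) (cong (2 ^ d *_) (trans (^-*-assoc 49 50 d) (cong (49 ^_) (*-comm 50 d)))))
                       (trans (^-*-assoc 50 50 d) (cong (50 ^_) (*-comm 50 d)))
                       (^-monoˡ-≤ d (by-computation (2 * 49 ^ 50) (50 ^ 50)))
    lhs : (X * X * 50 ^ d) ^ 50 ≡ X ^ 100 * 50 ^ (d * 50)
    lhs = trans (^-distribʳ-* (X * X) (50 ^ d) 50)
                (cong₂ _*_ (trans (cong (_^ 50) (cong (X *_) (sym (*-identityʳ X)))) (^-*-assoc X 2 50)) (^-*-assoc 50 d 50))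
    rhs : (49 ^ d * 2 ^ n) ^ 50 ≡ 49 ^ (d * 50) * 2 ^ (50 * n)
    rhs = trans (^-distribʳ-* (49 ^ d) (2 ^ n) 50) (cong₂ _*_ (^-*-assoc 49 d 50) (trans (^-*-assoc 2 n 50) (cong (2 ^_) (*-comm n 50))))
    regroup : ∀ a y t → a * (y * t) ≡ y * (t * a)
    regroup = solve-∀

  exponent-bound : ∀ X n d p q → X ^ 100 * 2 ^ d ≤ 2 ^ (50 * n) → 2 ^ p ≤ X ^ q → 100 * p + d * q ≤ 50 * n * q
  exponent-bound X n d p q bound 2^p≤X^q = 2^-cancel-≤ _ _ (begin
      2 ^ (100 * p + d * q)          ≡⟨ ^-distribˡ-+-* 2 (100 * p) (d * q) ⟩
      2 ^ (100 * p) * 2 ^ (d * q)    ≡⟨ cong₂ _*_ (trans (cong (2 ^_) (*-comm 100 p)) (sym (^-*-assoc 2 p 100))) (sym (^-*-assoc 2 d q)) ⟩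
      (2 ^ p) ^ 100 * (2 ^ d) ^ q    ≤⟨ *-monoˡ-≤ ((2 ^ d) ^ q) (^-monoˡ-≤ 100 2^p≤X^q) ⟩
      (X ^ q) ^ 100 * (2 ^ d) ^ q    ≡⟨ cong (_* (2 ^ d) ^ q) (trans (^-*-assoc X q 100) (trans (cong (X ^_) (*-comm q 100)) (sym (^-*-assoc X 100 q)))) ⟩
      (X ^ 100) ^ q * (2 ^ d) ^ q    ≡⟨ sym (^-distribʳ-* (X ^ 100) (2 ^ d) q) ⟩
      (X ^ 100 * 2 ^ d) ^ q          ≤⟨ ^-monoˡ-≤ q bound ⟩
      (2 ^ (50 * n)) ^ q             ≡⟨ ^-*-assoc 2 (50 * n) q ⟩
      2 ^ (50 * n * q)               ∎)
    where open ≤-Reasoning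

  -- The remaining linear arithmetic: with n = 2m + d, the hypothesis en < Fd (i.e. im < (1 − e/F) n/2)
  -- contradicts 100p + dq ≤ 50nq when p/q = (1/2 − e/(100F)) n.
  exponent-contradiction : ∀ m d F e p q → 1 ≤ q →
    2 * m * F + e * (m + m + d) < F * (m + m + d) →
    p * (200 * F) + 2 * e * (m + m + d) * q ≡ 100 * F * (m + m + d) * q →
    100 * p + d * q ≤ 50 * (m + m + d) * q → ⊥
  exponent-contradiction m d F e p q 1≤q im-small p/q≡ exponents = <⇒≱ en<Fd Fd≤en
    where
    n = m + m + d
    en<Fd : e * n < F * d
    en<Fd = +-cancelˡ-< (2 * m * F) (e * n) (F * d) (subst (2 * m * F + e * n <_) (expand m d F) im-small)
      where
      expand : ∀ m d F → F * (m + m + d) ≡ 2 * m * F + F * d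
      expand = solve-∀
    Fd≤en : F * d ≤ e * n
    Fd≤en = *-cancelʳ-≤ (F * d) (e * n) (2 * q) {{m*n≢0 2 q {{_}} {{>-nonZero 1≤q}}}}
      (+-cancelˡ-≤ (p * (200 * F)) _ _ (subst₂ _≤_ (expandˡ p F d q) (trans (expandʳ F n q) (trans (sym p/q≡) (regroup p F e n q)))
        (*-monoʳ-≤ (2 * F) exponents)))
      where
      expandˡ : ∀ p F d q → 2 * F * (100 * p + d * q) ≡ p * (200 * F) + F * d * (2 * q)
      expandˡ = solve-∀
      expandʳ : ∀ F n q → 2 * F * (50 * n * q) ≡ 100 * F * n * q
      expandʳ = solve-∀
      regroup : ∀ p F e n q → p * (200 * F) + 2 * e * n * q ≡ p * (200 * F) + e * n * (2 * q)
      regroup = solve-∀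

  factorˡ-nonZero : ∀ {a} F n → a < F * n → NonZero F
  factorˡ-nonZero (suc F) n _ = _
  factorʳ-nonZero : ∀ {a} F n → a < F * n → NonZero n
  factorʳ-nonZero {a} F zero a<F*0 = ⊥-elim (n≮0 (subst (a <_) (*-zeroʳ F) a<F*0))
  factorʳ-nonZero F (suc n) _ = _

  -- The logarithmic form of the main lemma: if mis(G) obeys the main bound, im < (1 − e/F) n/2
  -- and p/q = (1/2 − e/(100F)) n, then mis(G)^q < 2^p, i.e. log₂ mis(G) < p/q.
  log-mis-bound : ∀ X m n F e p q → 1 ≤ q → X * (5 ^ n * 49 ^ m) ≤ 7 ^ n * 50 ^ m →
    2 * m * F + e * n < F * n → p * (200 * F) + 2 * e * n * q ≡ 100 * F * n * q → X ^ q < 2 ^ p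
  log-mis-bound X m n F e p q 1≤q bound im-small p/q≡ with 2 ^ p ≤? X ^ q | m≤n⇒∃[o]m+o≡n 2m≤n
    where
    2m≤n : m + m ≤ n
    2m≤n = *-cancelʳ-≤ (m + m) n F {{F≢0}} (≤-trans (≤-reflexive (double m F)) (≤-trans (m≤m+n (2 * m * F) (e * n))
             (≤-trans (<⇒≤ im-small) (≤-reflexive (*-comm F n)))))
      where
      double : ∀ m F → (m + m) * F ≡ 2 * m * F
      double = solve-∀
      F≢0 : NonZero F
      F≢0 = factorˡ-nonZero F n im-small
  ... | no X^q≱2^p | _ = ≰⇒> X^q≱2^p
  ... | yes 2^p≤X^q | d , refl = ⊥-elim (exponent-contradiction m d F e p q 1≤q im-small p/q≡
        (exponent-bound X (m + m + d) d p q (to-powers-of-two X (m + m + d) d (square X m d (halve X m d bound))) 2^p≤X^q))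

open LogMisBound using (mis-bound; log-mis-bound; factorʳ-nonZero)
open import Data.Nat as ℕ using (ℕ; suc; zero)
import Data.Nat.Properties as ℕₚ
import Data.Nat.Tactic.RingSolver as ℕ-Solver
open import Data.Integer as ℤ using (ℤ; +_; -[1+_])
import Data.Integer.Properties as ℤₚ
open import Data.Integer.Tactic.RingSolver using (solve-∀)
open import Data.Nat.Coprimality using (1-coprimeTo) renaming (sym to coprime-sym)
import Data.Rational as ℚ
open import Data.Rational using (ℚ; 0ℚ; 1ℚ; ½; _*_; _-_; _<_; _≤_; _/_; mkℚ; toℚᵘ; ↥_; ↧ₙ_; -_)
import Data.Rational.Properties as ℚₚ
open import Data.Rational.Unnormalised as ℚᵘ using (ℚᵘ; mkℚᵘ; *≡*; *<*)
import Data.Rational.Unnormalised.Properties as ℚᵘₚ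
open import Data.Product using (Σ; _×_; _,_; proj₁; proj₂)
open import Data.Empty using (⊥-elim)
open import Relation.Binary.PropositionalEquality

c : ℚ
c = + 1 / 100

toℚᵘ-ℕ : ∀ a → toℚᵘ (+ a / 1) ≡ mkℚᵘ (+ a) 0
toℚᵘ-ℕ a = cong toℚᵘ (ℚₚ.normalize-coprime (coprime-sym (1-coprimeTo a)))

matching-threshold : ℚᵘ → ℕ → ℚᵘ
matching-threshold x n = ((mkℚᵘ (+ 1) 0 ℚᵘ.+ ℚᵘ.- x) ℚᵘ.* mkℚᵘ (+ n) 0) ℚᵘ.* mkℚᵘ (+ 1) 1
matching-threshold-≃ : ∀ ε n → toℚᵘ ((1ℚ - ε) * (+ n / 1) * ½) ℚᵘ.≃ matching-threshold (toℚᵘ ε) n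
matching-threshold-≃ ε n =
  ℚᵘₚ.≃-trans (ℚₚ.toℚᵘ-homo-* ((1ℚ - ε) * (+ n / 1)) ½)
    (ℚᵘₚ.*-cong (ℚᵘₚ.≃-trans (ℚₚ.toℚᵘ-homo-* (1ℚ - ε) (+ n / 1))
                  (ℚᵘₚ.*-cong (ℚᵘₚ.≃-trans (ℚₚ.toℚᵘ-homo-+ 1ℚ (- ε)) (ℚᵘₚ.+-cong (ℚᵘₚ.≃-refl {toℚᵘ 1ℚ}) (ℚₚ.toℚᵘ-homo‿- ε)))
                              (ℚᵘₚ.≃-reflexive (toℚᵘ-ℕ n))))
                (ℚᵘₚ.≃-refl {toℚᵘ ½}))

log-target : ℚᵘ → ℕ → ℚᵘ
log-target x n = (mkℚᵘ (+ 1) 1 ℚᵘ.+ ℚᵘ.- (mkℚᵘ (+ 1) 99 ℚᵘ.* x)) ℚᵘ.* mkℚᵘ (+ n) 0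
log-target-≃ : ∀ ε n → toℚᵘ ((½ - c * ε) * (+ n / 1)) ℚᵘ.≃ log-target (toℚᵘ ε) n
log-target-≃ ε n =
  ℚᵘₚ.≃-trans (ℚₚ.toℚᵘ-homo-* (½ - c * ε) (+ n / 1))
    (ℚᵘₚ.*-cong (ℚᵘₚ.≃-trans (ℚₚ.toℚᵘ-homo-+ ½ (- (c * ε)))
                  (ℚᵘₚ.+-cong (ℚᵘₚ.≃-refl {toℚᵘ ½}) (ℚᵘₚ.≃-trans (ℚₚ.toℚᵘ-homo‿- (c * ε)) (ℚᵘₚ.-‿cong (ℚₚ.toℚᵘ-homo-* c ε)))))
                (ℚᵘₚ.≃-reflexive (toℚᵘ-ℕ n)))

-- For ε = e/F (F = f + 1), the hypothesis im < (1 − ε)·n/2 in ℕ: 2·im·F + e·n < F·n.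
matching-hypothesis-ℕ : ∀ e f n m → mkℚᵘ (+ m) 0 ℚᵘ.< matching-threshold (mkℚᵘ (+ e) f) n →
  2 ℕ.* m ℕ.* suc f ℕ.+ e ℕ.* n ℕ.< suc f ℕ.* n
matching-hypothesis-ℕ e f n m (*<* cross) = ℤₚ.drop‿+<+ (subst₂ ℤ._<_ lhs rhs (ℤₚ.+-monoˡ-< (+ (e ℕ.* n)) cross′))
  where
  F = suc f
  denominator : ℚᵘ.↧ (matching-threshold (mkℚᵘ (+ e) f) n) ≡ + (2 ℕ.* F)
  denominator = cong +_ (normalise f)
    where
    normalise : ∀ f → suc (suc ((f ℕ.+ 0 ℕ.* suc f) ℕ.* 1 ℕ.* 2)) ≡ 2 ℕ.* suc f
    normalise = ℕ-Solver.solve-∀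
  cross′ : + m ℤ.* + (2 ℕ.* F) ℤ.< ((+ 1 ℤ.* + F ℤ.+ (ℤ.- + e) ℤ.* + 1) ℤ.* + n) ℤ.* + 1 ℤ.* + 1
  cross′ = subst (λ z → + m ℤ.* z ℤ.< ((+ 1 ℤ.* + F ℤ.+ (ℤ.- + e) ℤ.* + 1) ℤ.* + n) ℤ.* + 1 ℤ.* + 1) denominator cross
  lhs : + m ℤ.* + (2 ℕ.* F) ℤ.+ + (e ℕ.* n) ≡ + (2 ℕ.* m ℕ.* F ℕ.+ e ℕ.* n)
  lhs = trans (cong₂ ℤ._+_ (cong (+ m ℤ.*_) (ℤₚ.pos-* 2 F)) (ℤₚ.pos-* e n))
          (trans (regroup (+ m) (+ F) (+ e) (+ n))
            (sym (trans (ℤₚ.pos-+ (2 ℕ.* m ℕ.* F) (e ℕ.* n))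
                   (cong₂ ℤ._+_ (trans (ℤₚ.pos-* (2 ℕ.* m) F) (cong (ℤ._* + F) (ℤₚ.pos-* 2 m))) (ℤₚ.pos-* e n)))))
    where
    regroup : ∀ M F E N → M ℤ.* (+ 2 ℤ.* F) ℤ.+ E ℤ.* N ≡ + 2 ℤ.* M ℤ.* F ℤ.+ E ℤ.* N
    regroup = solve-∀
  rhs : ((+ 1 ℤ.* + F ℤ.+ (ℤ.- + e) ℤ.* + 1) ℤ.* + n) ℤ.* + 1 ℤ.* + 1 ℤ.+ + (e ℕ.* n) ≡ + (F ℕ.* n)
  rhs = trans (cong (λ z → ((+ 1 ℤ.* + F ℤ.+ (ℤ.- + e) ℤ.* + 1) ℤ.* + n) ℤ.* + 1 ℤ.* + 1 ℤ.+ z) (ℤₚ.pos-* e n))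
              (trans (cancel (+ F) (+ e) (+ n)) (sym (ℤₚ.pos-* F n)))
    where
    cancel : ∀ F E N → ((+ 1 ℤ.* F ℤ.+ (ℤ.- E) ℤ.* + 1) ℤ.* N) ℤ.* + 1 ℤ.* + 1 ℤ.+ E ℤ.* N ≡ F ℤ.* N
    cancel = solve-∀

natural-solution : ∀ (z : ℤ) a b c → b ℕ.< c → z ℤ.* + a ℤ.+ + b ≡ + c → Σ ℕ (λ p → (z ≡ + p) × (p ℕ.* a ℕ.+ b ≡ c))
natural-solution (+ p) a b c _ eq = p , refl , ℤₚ.+-injective (trans (trans (ℤₚ.pos-+ (p ℕ.* a) b) (cong (ℤ._+ + b) (ℤₚ.pos-* p a))) eq)
natural-solution -[1+ k ] a b c b<c eq = ⊥-elim (ℕₚ.<⇒≱ b<c (subst (c ℕ.≤_) (sym b≡c+A) (ℕₚ.m≤m+n c A)))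
  where
  A = suc k ℕ.* a
  negative : -[1+ k ] ℤ.* + a ≡ ℤ.- (+ A)
  negative = trans (sym (ℤₚ.neg-distribˡ-* (+ suc k) (+ a))) (cong ℤ.-_ (sym (ℤₚ.pos-* (suc k) a)))
  move : ∀ A B → B ≡ (ℤ.- A ℤ.+ B) ℤ.+ A
  move = solve-∀
  b≡c+A : b ≡ c ℕ.+ A
  b≡c+A = ℤₚ.+-injective (trans (move (+ A) (+ b)) (trans (cong (ℤ._+ + A) (trans (cong (ℤ._+ + b) (sym negative)) eq)) (sym (ℤₚ.pos-+ c A))))

log-target-numerator : ∀ e f n (r : ℚ) → toℚᵘ r ℚᵘ.≃ log-target (mkℚᵘ (+ e) f) n → e ℕ.* n ℕ.< suc f ℕ.* n →
  Σ ℕ (λ p → (↥ r ≡ + p) × (p ℕ.* (200 ℕ.* suc f) ℕ.+ 2 ℕ.* e ℕ.* n ℕ.* (↧ₙ r) ≡ 100 ℕ.* suc f ℕ.* n ℕ.* (↧ₙ r)))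
log-target-numerator e f n (mkℚ z d _) (*≡* cross) en<Fn = natural-solution z (200 ℕ.* F) B C B<C z-equation
  where
  F = suc f
  q = suc d
  denominator : ℚᵘ.↧ (log-target (mkℚᵘ (+ e) f) n) ≡ + (200 ℕ.* F)
  denominator = cong +_ (normalise f)
    where
    normalise : ∀ f → suc ((f ℕ.+ 99 ℕ.* suc f ℕ.+ 1 ℕ.* suc (f ℕ.+ 99 ℕ.* suc f)) ℕ.* 1) ≡ 200 ℕ.* suc f
    normalise = ℕ-Solver.solve-∀
  denominator-cε : ℚᵘ.↧ (mkℚᵘ (+ 1) 99 ℚᵘ.* mkℚᵘ (+ e) f) ≡ + (100 ℕ.* F)
  denominator-cε = cong +_ (normalise f)
    where
    normalise : ∀ f → suc (f ℕ.+ 99 ℕ.* suc f) ≡ 100 ℕ.* suc f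
    normalise = ℕ-Solver.solve-∀
  cross′ : z ℤ.* + (200 ℕ.* F) ≡ ((+ 1 ℤ.* + (100 ℕ.* F) ℤ.+ (ℤ.- (+ 1 ℤ.* + e)) ℤ.* + 2) ℤ.* + n) ℤ.* + q
  cross′ = subst₂ (λ a b → z ℤ.* a ≡ ((+ 1 ℤ.* b ℤ.+ (ℤ.- (+ 1 ℤ.* + e)) ℤ.* + 2) ℤ.* + n) ℤ.* + q) denominator denominator-cε cross
  B = 2 ℕ.* e ℕ.* n ℕ.* q
  C = 100 ℕ.* F ℕ.* n ℕ.* q
  B-ℤ : + B ≡ + 2 ℤ.* + e ℤ.* + n ℤ.* + q
  B-ℤ = trans (ℤₚ.pos-* (2 ℕ.* e ℕ.* n) q) (cong (ℤ._* + q) (trans (ℤₚ.pos-* (2 ℕ.* e) n) (cong (ℤ._* + n) (ℤₚ.pos-* 2 e))))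
  C-ℤ : + C ≡ + (100 ℕ.* F) ℤ.* + n ℤ.* + q
  C-ℤ = trans (ℤₚ.pos-* (100 ℕ.* F ℕ.* n) q) (cong (ℤ._* + q) (ℤₚ.pos-* (100 ℕ.* F) n))
  z-equation : z ℤ.* + (200 ℕ.* F) ℤ.+ + B ≡ + C
  z-equation = trans (cong₂ ℤ._+_ cross′ B-ℤ) (trans (cancel (+ (100 ℕ.* F)) (+ e) (+ n) (+ q)) (sym C-ℤ))
    where
    cancel : ∀ H E N Q → ((+ 1 ℤ.* H ℤ.+ (ℤ.- (+ 1 ℤ.* E)) ℤ.* + 2) ℤ.* N) ℤ.* Q ℤ.+ + 2 ℤ.* E ℤ.* N ℤ.* Q ≡ H ℤ.* N ℤ.* Q
    cancel = solve-∀
  -- B < C because e < F.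
  B<C : B ℕ.< C
  B<C = ℕₚ.*-monoˡ-< q (ℕₚ.*-monoˡ-< n {{factorʳ-nonZero F n en<Fn}} (ℕₚ.<-≤-trans (ℕₚ.*-monoʳ-< 2 e<F) (ℕₚ.*-monoˡ-≤ F (ℕₚ.m≤m+n 2 98))))
    where
    e<F : e ℕ.< F
    e<F = ℕₚ.*-cancelʳ-< n e F en<Fn

log-mis-small : (ε : ℚ) → 0ℚ < ε → (n : ℕ) → (G : Graph n) → TriangleFree G →
  (+ im G / 1) < (1ℚ - ε) * (+ n / 1) * ½ → Log2Lt (mis G) ((½ - c * ε) * (+ n / 1))
log-mis-small (mkℚ -[1+ _ ] _ _) (ℚ.*<* ()) n G triangleFree im-small
log-mis-small ε@(mkℚ (+ e) f _) _ n G triangleFree im-small =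
  p , ↥r≡p , log-mis-bound (mis G) (im G) n (suc f) e p (↧ₙ r) (ℕ.s≤s ℕ.z≤n) (mis-bound G triangleFree) im-small-ℕ p-equation
  where
  im-small-ℕ : 2 ℕ.* im G ℕ.* suc f ℕ.+ e ℕ.* n ℕ.< suc f ℕ.* n
  im-small-ℕ = matching-hypothesis-ℕ e f n (im G)
    (ℚᵘₚ.<-respʳ-≃ (matching-threshold-≃ ε n) (subst (ℚᵘ._< _) (toℚᵘ-ℕ (im G)) (ℚₚ.toℚᵘ-mono-< im-small)))
  r = (½ - c * ε) * (+ n / 1)
  numerator = log-target-numerator e f n r (log-target-≃ ε n) (ℕₚ.≤-trans (ℕ.s≤s (ℕₚ.m≤n+m (e ℕ.* n) _)) im-small-ℕ)
  p = proj₁ numerator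
  ↥r≡p = proj₁ (proj₂ numerator)
  p-equation = proj₂ (proj₂ numerator)

theorem1p4 : Σ ℚ (λ c → (0ℚ < c) × ((ε : ℚ) → 0ℚ < ε → Σ ℚ (λ δ → (c * ε ≤ δ) × ((n : ℕ) → (G : Graph n) → TriangleFree G → (+ im G / 1) < (1ℚ - ε) * (+ n / 1) * ½ → Log2Lt (mis G) ((½ - δ) * (+ n / 1))))))
theorem1p4 = c , ℚ.*<* (ℤ.+<+ (ℕ.s≤s ℕ.z≤n)) , λ ε ε>0 → c * ε , ℚₚ.≤-refl , log-mis-small ε ε>0
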